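{- For any noncrossing perfect matching $\pi$ of size $n$, we have $\sum_{p=1}^{n-1} m_p(\pi)\le d(\pi)$, and $d(\pi)-\sum_{p=1}^{n-1} m_p(\pi)$ is an even integer.
   Context: A matching of size $n$ is a set of $n$ disjoint pairs $\{i,j\}$ (arches) whose union is $\{1,\ldots,2n\}$, noncrossing: no two arches $\{i<j\}$, $\{k<l\}$ with $i<k<j<l$. Write $\widehat{x}=2n+1-x$. For $1\le p\le n-1$, let $\mathcal{A}_p^L(\pi)$ be the set of arches $\{a_1<a_2\}$ with $a_1\le p$ and $p<a_2<\widehat{p}$, and $\mathcal{A}_p^R(\pi)$ the set of arches $\{a_1<a_2\}$ with $p<a_1<\widehat{p}$ and $\widehat{p}\le a_2$; set $m_p(\pi)=\frac12(|\mathcal{A}_p^L(\pi)|+|\mathcal{A}_p^R(\pi)|)$ (an integer). Let $a_1<\cdots<a_n$ be the smaller elements of the arches of $\pi$; $d(\pi)=\sum_{i=1}^n (a_i-i)$ is the number of boxes of the Young diagram $Y(\pi)$ with row lengths $a_n-n\ge\cdots\ge a_1-1$. -}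

module Defs where

open import Data.Nat using (ℕ; zero; suc; _+_; _*_; _∸_; _≤_; _<_; _≤?_; _<?_; _≟_)
open import Data.Nat.DivMod using (_/_)
open import Data.Product using (_×_; _,_; proj₁; proj₂)
open import Data.List using (List; []; _∷_; map; filter; length; upTo; concatMap)
open import Data.Nat.ListAction using (sum)
open import Data.List.Relation.Unary.All using (All)
open import Data.List.Relation.Unary.Any using (any?)
open import Data.List.Relation.Binary.Permutation.Propositional using (_↭_)
open import Relation.Nullary using (¬_)
open import Relation.Nullary.Decidable using (_×-dec_)

Arch : Set
Arch = ℕ × ℕ

endpoints : List Arch → List ℕ
endpoints = concatMap (λ a → proj₁ a ∷ proj₂ a ∷ [])

range1 : ℕ → List ℕ
range1 m = map suc (upTo m)

Crossing : Arch → Arch → Set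
Crossing (i , j) (k , l) = i < k × k < j × j < l

-- A noncrossing perfect matching of size n on {1,…,2n}:
-- a list of arches (i , j) with i < j, whose endpoints are (as a multiset)
-- exactly 1,…,2n (so the arches are disjoint and cover {1,…,2n}),
-- and no two of which cross.
record NCMatching (n : ℕ) : Set where
  field
    arches      : List Arch
    ordered     : All (λ a → proj₁ a < proj₂ a) arches
    perfect     : endpoints arches ↭ range1 (2 * n)
    noncrossing : All (λ a → All (λ b → ¬ Crossing a b) arches) arches
open NCMatching public

hat : ℕ → ℕ → ℕ
hat n x = (2 * n + 1) ∸ x

countL : (n : ℕ) → NCMatching n → ℕ → ℕ
countL n π p = length (filter (λ a → (proj₁ a ≤? p) ×-dec ((p <? proj₂ a) ×-dec (proj₂ a <? hat n p))) (arches π))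

countR : (n : ℕ) → NCMatching n → ℕ → ℕ
countR n π p = length (filter (λ a → (p <? proj₁ a) ×-dec ((proj₁ a <? hat n p) ×-dec (hat n p ≤? proj₂ a))) (arches π))

-- m_p(π) = (|A^L_p| + |A^R_p|) / 2  (an integer, per the paper)
mp : (n : ℕ) → NCMatching n → ℕ → ℕ
mp n π p = (countL n π p + countR n π p) / 2

sumM : (n : ℕ) → NCMatching n → ℕ
sumM n π = sum (map (mp n π) (range1 (n ∸ 1)))

openers : (n : ℕ) → NCMatching n → List ℕ
openers n π = filter (λ x → any? (λ a → proj₁ a ≟ x) (arches π)) (range1 (2 * n))

sumShift : ℕ → List ℕ → ℕ
sumShift k []       = 0
sumShift k (a ∷ as) = (a ∸ k) + sumShift (suc k) as

d : (n : ℕ) → NCMatching n → ℕ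
d n π = sumShift 1 (openers n π)

module Submission where

-- For an arch α write lo α < hi α for its endpoints.  A single
-- counting principle drives everything: the endpoints of the arches are exactly
-- 1, …, 2n, so a sum over positions equals the sum over arches of its values at
-- both endpoints (∑-positions).  It yields, for every arch α, the numbers nLeft,
-- nRight, nOuter and nInner of arches left of, right of, around and inside α, and
--   * d(π) = Σ_α nLeft(α), the number of disjoint pairs (d-formula);
--   * m_p = #{lo ≤ p} − #{lo ≥ p̂} − #{lo ≤ p, p̂ ≤ hi} for 0 < p < n (mp-formula),
--     hence Σ_p m_p = Σ_α opened(α) − Σ_α excess(α) (sumM-formula).
-- Sorting the arches into the classes L (hi ≤ n), S (lo ≤ n < hi) and R (n < lo),
-- opened and excess are expressed class by class through the neighbourhood
-- numbers, and the pairs inside L and inside R are counted with the pair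
-- trichotomy (disjoint / nested / equal).  Linear bookkeeping (class-bookkeeping)
-- then gives the exact identity
--   d(π) = Σ_p m_p + 2K,   K = Σ_L nLeft + Σ_R nRight + Σ_S min(nLeft, nRight),
-- from which both claims of Proposition 3.3 are immediate.

open import Defs
open import Data.Nat using (ℕ; zero; suc; _+_; _*_; _∸_; _≤_; _<_; _>_; _≤?_; _<?_; _≟_; z≤n; s≤s; s≤s⁻¹; _⊓_; _⊔_)
open import Data.Nat.Properties
open import Data.Nat.DivMod using (_/_; m*n/n≡m)
open import Data.Nat.Divisibility using (_∣_; divides)
open import Data.Nat.ListAction using (sum)
open import Data.Nat.ListAction.Properties using (sum-↭)
open import Data.Nat.Tactic.RingSolver using (solve-∀)
open import Data.Product using (_×_; _,_; proj₁; proj₂)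
open import Data.Product.Properties using (≡-dec)
open import Data.Sum using (_⊎_; inj₁; inj₂)
open import Data.List using (List; []; _∷_; _++_; map; filter; length; upTo)
open import Data.List.Properties using (upTo-∷ʳ; map-++; length-map; length-upTo; filter-++; filter-accept; filter-reject)
open import Data.List.Membership.Propositional using (_∈_; lose; find)
open import Data.List.Relation.Unary.Any using (Any; here; there; any?)
import Data.List.Relation.Unary.All as All
open import Data.List.Relation.Binary.Permutation.Propositional using (_↭_)
open import Data.List.Relation.Binary.Permutation.Propositional.Properties using (map⁺)
open import Data.Empty using (⊥-elim)
open import Relation.Nullary using (Dec; yes; no; ¬_; _×-dec_)
open import Relation.Binary.Definitions using (Tri; tri<; tri≈; tri>)
open import Relation.Binary.PropositionalEquality

∑ : {A : Set} → List A → (A → ℕ) → ℕ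
∑ []       f = 0
∑ (x ∷ xs) f = f x + ∑ xs f

syntax ∑ xs (λ x → e) = ∑[ x ∈ xs ] e

module _ {A : Set} where

  ∑-map : (xs : List A) (f : A → ℕ) → sum (map f xs) ≡ ∑ xs f
  ∑-map []       f = refl
  ∑-map (x ∷ xs) f = cong (f x +_) (∑-map xs f)

  ∑-++ : (xs ys : List A) (f : A → ℕ) → ∑ (xs ++ ys) f ≡ ∑ xs f + ∑ ys f
  ∑-++ []       ys f = refl
  ∑-++ (x ∷ xs) ys f = trans (cong (f x +_) (∑-++ xs ys f)) (sym (+-assoc (f x) _ _))

  ∑-+ : (xs : List A) (f g : A → ℕ) → ∑[ x ∈ xs ] (f x + g x) ≡ ∑ xs f + ∑ xs g
  ∑-+ []       f g = refl
  ∑-+ (x ∷ xs) f g = trans (cong (f x + g x +_) (∑-+ xs f g)) (interchange (f x) (g x) _ _)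
    where
    interchange : ∀ a b c d → a + b + (c + d) ≡ a + c + (b + d)
    interchange = solve-∀

  ∑-*ˡ : (xs : List A) (c : ℕ) (f : A → ℕ) → ∑[ x ∈ xs ] (c * f x) ≡ c * ∑ xs f
  ∑-*ˡ []       c f = sym (*-zeroʳ c)
  ∑-*ˡ (x ∷ xs) c f = trans (cong (c * f x +_) (∑-*ˡ xs c f)) (sym (*-distribˡ-+ c (f x) _))

  ∑-zero : (xs : List A) → ∑[ x ∈ xs ] 0 ≡ 0
  ∑-zero []       = refl
  ∑-zero (x ∷ xs) = ∑-zero xs

  ∑-one : (xs : List A) → ∑[ x ∈ xs ] 1 ≡ length xs
  ∑-one []       = refl
  ∑-one (x ∷ xs) = cong suc (∑-one xs)

  ∑-cong : (xs : List A) {f g : A → ℕ} → (∀ {x} → x ∈ xs → f x ≡ g x) → ∑ xs f ≡ ∑ xs g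
  ∑-cong []       h = refl
  ∑-cong (x ∷ xs) h = cong₂ _+_ (h (here refl)) (∑-cong xs (λ m → h (there m)))

  ∑-member : (xs : List A) (f : A → ℕ) {x : A} → x ∈ xs → f x ≤ ∑ xs f
  ∑-member (y ∷ xs) f (here refl) = m≤m+n (f y) _
  ∑-member (y ∷ xs) f (there m)   = ≤-trans (∑-member xs f m) (m≤n+m _ (f y))

  ∑-two-members : (xs : List A) (f : A → ℕ) {x y : A} → x ∈ xs → y ∈ xs → x ≢ y → f x + f y ≤ ∑ xs f
  ∑-two-members (z ∷ xs) f (here refl) (here refl) x≢y = ⊥-elim (x≢y refl)
  ∑-two-members (z ∷ xs) f (here refl) (there my)  _   = +-monoʳ-≤ (f z) (∑-member xs f my)
  ∑-two-members (z ∷ xs) f (there mx)  (here refl) _   =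
    subst (_≤ f z + ∑ xs f) (+-comm (f z) _) (+-monoʳ-≤ (f z) (∑-member xs f mx))
  ∑-two-members (z ∷ xs) f (there mx)  (there my)  x≢y = ≤-trans (∑-two-members xs f mx my x≢y) (m≤n+m _ (f z))

∑-swap : {A B : Set} (xs : List A) (ys : List B) (f : A → B → ℕ) →
  ∑[ x ∈ xs ] ∑[ y ∈ ys ] f x y ≡ ∑[ y ∈ ys ] ∑[ x ∈ xs ] f x y
∑-swap []       ys f = sym (∑-zero ys)
∑-swap (x ∷ xs) ys f = trans (cong (∑ ys (f x) +_) (∑-swap xs ys f)) (sym (∑-+ ys (f x) _))

∑-↭ : {xs ys : List ℕ} → xs ↭ ys → (g : ℕ → ℕ) → ∑ xs g ≡ ∑ ys g
∑-↭ {xs} {ys} p g = trans (sym (∑-map xs g)) (trans (sum-↭ (map⁺ g p)) (∑-map ys g))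

𝟙 : {P : Set} → Dec P → ℕ
𝟙 (yes _) = 1
𝟙 (no  _) = 0

module _ {P : Set} where

  𝟙-yes : (d : Dec P) → P → 𝟙 d ≡ 1
  𝟙-yes (yes _) _ = refl
  𝟙-yes (no ¬p) p = ⊥-elim (¬p p)

  𝟙-no : (d : Dec P) → ¬ P → 𝟙 d ≡ 0
  𝟙-no (yes p) ¬p = ⊥-elim (¬p p)
  𝟙-no (no _)  _  = refl

  𝟙-≤1 : (d : Dec P) → 𝟙 d ≤ 1
  𝟙-≤1 (yes _) = ≤-refl
  𝟙-≤1 (no _)  = z≤n

  𝟙-witness : (d : Dec P) → 0 < 𝟙 d → P
  𝟙-witness (yes p) _ = p

  𝟙-idem : (d : Dec P) → 𝟙 d * 𝟙 d ≡ 𝟙 d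
  𝟙-idem (yes _) = refl
  𝟙-idem (no _)  = refl

  𝟙-guard : (d : Dec P) {x y : ℕ} → (P → x ≡ y) → 𝟙 d * x ≡ 𝟙 d * y
  𝟙-guard (yes p) h = cong (_+ 0) (h p)
  𝟙-guard (no _)  h = refl

𝟙-iff : {P Q : Set} (dP : Dec P) (dQ : Dec Q) → (P → Q) → (Q → P) → 𝟙 dP ≡ 𝟙 dQ
𝟙-iff (yes _) (yes _) _ _ = refl
𝟙-iff (yes p) (no ¬q) f _ = ⊥-elim (¬q (f p))
𝟙-iff (no ¬p) (yes q) _ g = ⊥-elim (¬p (g q))
𝟙-iff (no _)  (no _)  _ _ = refl

𝟙-× : {P Q : Set} (dP : Dec P) (dQ : Dec Q) → 𝟙 (dP ×-dec dQ) ≡ 𝟙 dP * 𝟙 dQ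
𝟙-× (yes _) (yes _) = refl
𝟙-× (yes _) (no _)  = refl
𝟙-× (no _)  _       = refl

𝟙-≤-< : ∀ c p → 𝟙 (c ≤? p) + 𝟙 (p <? c) ≡ 1
𝟙-≤-< c p with c ≤? p | p <? c
... | yes c≤p | yes p<c = ⊥-elim (<-irrefl refl (<-≤-trans p<c c≤p))
... | yes _   | no _    = refl
... | no _    | yes _   = refl
... | no c≰p  | no p≮c  = ⊥-elim (c≰p (≮⇒≥ p≮c))

<⇒≤∸1 : ∀ {m x} → m < x → m ≤ x ∸ 1
<⇒≤∸1 (s≤s m≤x) = m≤x

≤∸1⇒< : ∀ {m x} → 1 ≤ m → m ≤ x ∸ 1 → m < x
≤∸1⇒< {suc m} {suc x} _ m≤x = s≤s m≤x

suc[∸1] : ∀ {x} → 1 ≤ x → suc (x ∸ 1) ≡ x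
suc[∸1] {suc x} _ = refl

range1-snoc : ∀ m → range1 (suc m) ≡ range1 m ++ suc m ∷ []
range1-snoc m = trans (cong (map suc) (sym (upTo-∷ʳ m))) (map-++ suc (upTo m) (m ∷ []))

length-range1 : ∀ m → length (range1 m) ≡ m
length-range1 m = trans (length-map suc (upTo m)) (length-upTo m)

∑-range1-snoc : ∀ m (g : ℕ → ℕ) → ∑ (range1 (suc m)) g ≡ ∑ (range1 m) g + g (suc m)
∑-range1-snoc m g = begin
  ∑ (range1 (suc m)) g                ≡⟨ cong (λ l → ∑ l g) (range1-snoc m) ⟩
  ∑ (range1 m ++ suc m ∷ []) g        ≡⟨ ∑-++ (range1 m) _ g ⟩
  ∑ (range1 m) g + (g (suc m) + 0)    ≡⟨ cong (∑ (range1 m) g +_) (+-identityʳ _) ⟩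
  ∑ (range1 m) g + g (suc m)          ∎
  where open ≡-Reasoning

∑-range1-cong : ∀ m {f g : ℕ → ℕ} → (∀ x → 1 ≤ x → x ≤ m → f x ≡ g x) → ∑ (range1 m) f ≡ ∑ (range1 m) g
∑-range1-cong zero    h = refl
∑-range1-cong (suc m) {f} {g} h = begin
  ∑ (range1 (suc m)) f        ≡⟨ ∑-range1-snoc m f ⟩
  ∑ (range1 m) f + f (suc m)  ≡⟨ cong₂ _+_ (∑-range1-cong m (λ x 1≤x x≤m → h x 1≤x (m≤n⇒m≤1+n x≤m)))
                                            (h (suc m) (s≤s z≤n) ≤-refl) ⟩
  ∑ (range1 m) g + g (suc m)  ≡⟨ sym (∑-range1-snoc m g) ⟩
  ∑ (range1 (suc m)) g        ∎
  where open ≡-Reasoning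

∑-below : ∀ M x (f : ℕ → ℕ) → ∑[ y ∈ range1 M ] (𝟙 (y <? x) * f y) ≡ ∑ (range1 (M ⊓ (x ∸ 1))) f
∑-below zero    x f = refl
∑-below (suc M) x f = trans (∑-range1-snoc M _) (step (suc M <? x))
  where
  open ≡-Reasoning
  step : (d : Dec (suc M < x)) →
    ∑[ y ∈ range1 M ] (𝟙 (y <? x) * f y) + 𝟙 d * f (suc M) ≡ ∑ (range1 (suc M ⊓ (x ∸ 1))) f
  step (yes M<x) = begin
    ∑[ y ∈ range1 M ] (𝟙 (y <? x) * f y) + (f (suc M) + 0)  ≡⟨ cong₂ _+_ (∑-below M x f) (+-identityʳ _) ⟩
    ∑ (range1 (M ⊓ (x ∸ 1))) f + f (suc M)                  ≡⟨ cong (λ z → ∑ (range1 z) f + f (suc M))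
                                                                      (m≤n⇒m⊓n≡m (≤-trans (n≤1+n M) (<⇒≤∸1 M<x))) ⟩
    ∑ (range1 M) f + f (suc M)                              ≡⟨ sym (∑-range1-snoc M f) ⟩
    ∑ (range1 (suc M)) f                                    ≡⟨ cong (λ z → ∑ (range1 z) f) (sym (m≤n⇒m⊓n≡m (<⇒≤∸1 M<x))) ⟩
    ∑ (range1 (suc M ⊓ (x ∸ 1))) f                          ∎
  step (no M≮x) = begin
    ∑[ y ∈ range1 M ] (𝟙 (y <? x) * f y) + 0  ≡⟨ +-identityʳ _ ⟩
    ∑[ y ∈ range1 M ] (𝟙 (y <? x) * f y)      ≡⟨ ∑-below M x f ⟩
    ∑ (range1 (M ⊓ (x ∸ 1))) f                ≡⟨ cong (λ z → ∑ (range1 z) f)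
                                                   (trans (m≥n⇒m⊓n≡n x∸1≤M) (sym (m≥n⇒m⊓n≡n (m≤n⇒m≤1+n x∸1≤M)))) ⟩
    ∑ (range1 (suc M ⊓ (x ∸ 1))) f            ∎
    where
    x∸1≤M : x ∸ 1 ≤ M
    x∸1≤M = ∸-monoˡ-≤ 1 (≮⇒≥ M≮x)

count-< : ∀ M x → ∑[ y ∈ range1 M ] 𝟙 (y <? x) ≡ M ⊓ (x ∸ 1)
count-< M x = begin
  ∑[ y ∈ range1 M ] 𝟙 (y <? x)        ≡⟨ ∑-cong (range1 M) (λ _ → sym (*-identityʳ _)) ⟩
  ∑[ y ∈ range1 M ] (𝟙 (y <? x) * 1)  ≡⟨ ∑-below M x (λ _ → 1) ⟩
  ∑[ y ∈ range1 (M ⊓ (x ∸ 1)) ] 1     ≡⟨ ∑-one (range1 (M ⊓ (x ∸ 1))) ⟩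
  length (range1 (M ⊓ (x ∸ 1)))       ≡⟨ length-range1 _ ⟩
  M ⊓ (x ∸ 1)                         ∎
  where open ≡-Reasoning

count-≤ : ∀ M x → ∑[ y ∈ range1 M ] 𝟙 (y ≤? x) ≡ M ⊓ x
count-≤ M x = trans (∑-cong (range1 M) (λ {y} _ → 𝟙-iff (y ≤? x) (y <? suc x) s≤s s≤s⁻¹)) (count-< M (suc x))

count-≥ : ∀ k c → 1 ≤ c → c ≤ suc k → ∑[ p ∈ range1 k ] 𝟙 (c ≤? p) + c ≡ suc k
count-≥ k c 1≤c c≤1+k = begin
  up + c                   ≡⟨ cong (up +_) (sym (suc[∸1] 1≤c)) ⟩
  up + suc (c ∸ 1)         ≡⟨ +-suc up (c ∸ 1) ⟩
  suc (up + (c ∸ 1))       ≡⟨ cong (λ z → suc (up + z)) (sym below) ⟩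
  suc (up + down)          ≡⟨ cong suc (sym (∑-+ (range1 k) _ _)) ⟩
  suc (∑[ p ∈ range1 k ] (𝟙 (c ≤? p) + 𝟙 (p <? c)))  ≡⟨ cong suc (∑-cong (range1 k) (λ {p} _ → 𝟙-≤-< c p)) ⟩
  suc (∑[ p ∈ range1 k ] 1)                           ≡⟨ cong suc (trans (∑-one (range1 k)) (length-range1 k)) ⟩
  suc k                    ∎
  where
  open ≡-Reasoning
  up down : ℕ
  up   = ∑[ p ∈ range1 k ] 𝟙 (c ≤? p)
  down = ∑[ p ∈ range1 k ] 𝟙 (p <? c)
  below : down ≡ c ∸ 1
  below = trans (count-< k c) (m≥n⇒m⊓n≡n (s≤s⁻¹ (subst (_≤ suc k) (sym (suc[∸1] 1≤c)) c≤1+k)))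

count-≡ : ∀ m x → ∑[ y ∈ range1 m ] 𝟙 (y ≟ x) ≡ 𝟙 ((1 ≤? x) ×-dec (x ≤? m))
count-≡ zero    x = sym (𝟙-no ((1 ≤? x) ×-dec (x ≤? 0)) (λ (1≤x , x≤0) → <-irrefl refl (≤-trans 1≤x x≤0)))
count-≡ (suc m) x = trans (∑-range1-snoc m _) (trans (cong (_+ 𝟙 (suc m ≟ x)) (count-≡ m x)) (step (<-cmp x (suc m))))
  where
  step : Tri (x < suc m) (x ≡ suc m) (x > suc m) → 𝟙 ((1 ≤? x) ×-dec (x ≤? m)) + 𝟙 (suc m ≟ x) ≡ 𝟙 ((1 ≤? x) ×-dec (x ≤? suc m))
  step (tri< x<1+m _ _)
    rewrite 𝟙-no (suc m ≟ x) (λ e → <-irrefl (sym e) x<1+m)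
    = trans (+-identityʳ _) (𝟙-iff _ _ (λ (1≤x , x≤m) → 1≤x , m≤n⇒m≤1+n x≤m) (λ (1≤x , _) → 1≤x , s≤s⁻¹ x<1+m))
  step (tri≈ _ refl _)
    rewrite 𝟙-no ((1 ≤? suc m) ×-dec (suc m ≤? m)) (λ (_ , 1+m≤m) → <-irrefl refl 1+m≤m)
          | 𝟙-yes (suc m ≟ suc m) refl
          | 𝟙-yes ((1 ≤? suc m) ×-dec (suc m ≤? suc m)) (s≤s z≤n , ≤-refl)
    = refl
  step (tri> _ _ 1+m<x)
    rewrite 𝟙-no ((1 ≤? x) ×-dec (x ≤? m)) (λ (_ , x≤m) → <-irrefl refl (≤-trans 1+m<x (m≤n⇒m≤1+n x≤m)))
          | 𝟙-no (suc m ≟ x) (λ e → <-irrefl e 1+m<x)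
          | 𝟙-no ((1 ≤? x) ×-dec (x ≤? suc m)) (λ (_ , x≤1+m) → <-irrefl refl (<-≤-trans 1+m<x x≤1+m))
    = refl

∑-endpoints : (As : List Arch) (g : ℕ → ℕ) → ∑ (endpoints As) g ≡ ∑[ α ∈ As ] (g (proj₁ α) + g (proj₂ α))
∑-endpoints []             g = refl
∑-endpoints ((a , b) ∷ As) g = trans (sym (+-assoc (g a) (g b) _)) (cong (g a + g b +_) (∑-endpoints As g))

length-filter≡∑ : {A : Set} {Q : A → Set} (Q? : (x : A) → Dec (Q x)) (xs : List A) →
  length (filter Q? xs) ≡ ∑[ x ∈ xs ] 𝟙 (Q? x)
length-filter≡∑ Q? []       = refl
length-filter≡∑ Q? (x ∷ xs) with Q? x
... | yes _ = cong suc (length-filter≡∑ Q? xs)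
... | no _  = length-filter≡∑ Q? xs

sumShift-++ : ∀ k (xs ys : List ℕ) → sumShift k (xs ++ ys) ≡ sumShift k xs + sumShift (k + length xs) ys
sumShift-++ k []       ys = cong (λ z → sumShift z ys) (sym (+-identityʳ k))
sumShift-++ k (x ∷ xs) ys = begin
  (x ∸ k) + sumShift (suc k) (xs ++ ys)
    ≡⟨ cong ((x ∸ k) +_) (sumShift-++ (suc k) xs ys) ⟩
  (x ∸ k) + (sumShift (suc k) xs + sumShift (suc k + length xs) ys)
    ≡⟨ sym (+-assoc (x ∸ k) _ _) ⟩
  (x ∸ k) + sumShift (suc k) xs + sumShift (suc k + length xs) ys
    ≡⟨ cong (λ z → (x ∸ k) + sumShift (suc k) xs + sumShift z ys) (sym (+-suc k (length xs))) ⟩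
  (x ∸ k) + sumShift (suc k) xs + sumShift (k + suc (length xs)) ys ∎
  where open ≡-Reasoning

-- If x is the i-th element of filter Q [1, …, m], then i − 1 is the number of
-- y < x satisfying Q; hence Σ_i (x_i − i) is the following sum over positions.
sumShift-filter : {Q : ℕ → Set} (Q? : (x : ℕ) → Dec (Q x)) (m : ℕ) →
  sumShift 1 (filter Q? (range1 m))
  ≡ ∑[ x ∈ range1 m ] (𝟙 (Q? x) * (x ∸ suc (∑[ y ∈ range1 (x ∸ 1) ] 𝟙 (Q? y))))
sumShift-filter Q? zero    = refl
sumShift-filter {Q} Q? (suc m) = begin
  sumShift 1 (filter Q? (range1 (suc m)))
    ≡⟨ cong (λ l → sumShift 1 (filter Q? l)) (range1-snoc m) ⟩
  sumShift 1 (filter Q? (range1 m ++ suc m ∷ []))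
    ≡⟨ cong (sumShift 1) (filter-++ Q? (range1 m) (suc m ∷ [])) ⟩
  sumShift 1 (filter Q? (range1 m) ++ filter Q? (suc m ∷ []))
    ≡⟨ sumShift-++ 1 (filter Q? (range1 m)) _ ⟩
  sumShift 1 (filter Q? (range1 m)) + sumShift (suc (length (filter Q? (range1 m)))) (filter Q? (suc m ∷ []))
    ≡⟨ cong₂ _+_ (sumShift-filter Q? m)
                 (trans (cong (λ z → sumShift (suc z) (filter Q? (suc m ∷ []))) (length-filter≡∑ Q? (range1 m))) (last (Q? (suc m)))) ⟩
  ∑ (range1 m) F + F (suc m)
    ≡⟨ sym (∑-range1-snoc m F) ⟩
  ∑ (range1 (suc m)) F ∎
  where
  open ≡-Reasoning
  F : ℕ → ℕ
  F x = 𝟙 (Q? x) * (x ∸ suc (∑[ y ∈ range1 (x ∸ 1) ] 𝟙 (Q? y)))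
  c : ℕ
  c = ∑[ y ∈ range1 m ] 𝟙 (Q? y)
  last : Dec (Q (suc m)) → sumShift (suc c) (filter Q? (suc m ∷ [])) ≡ F (suc m)
  last (yes q) = trans (cong (sumShift (suc c)) (filter-accept Q? q))
                       (trans (+-identityʳ _) (sym (trans (cong (_* (suc m ∸ suc c)) (𝟙-yes (Q? (suc m)) q)) (+-identityʳ _))))
  last (no ¬q) = trans (cong (sumShift (suc c)) (filter-reject Q? ¬q))
                       (sym (cong (_* (suc m ∸ suc c)) (𝟙-no (Q? (suc m)) ¬q)))

-- How an arch lo < hi meets the windows [1, p] and [h, ∞) for p < h: its
-- endpoints in [1, p] are both endpoints, or lo alone with hi inside (p, h),
-- or lo alone with hi ≥ h; symmetrically for [h, ∞).
left-window : ∀ lo hi p h → lo < hi → p < h →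
  𝟙 (lo ≤? p) * (𝟙 (p <? hi) * 𝟙 (hi <? h)) + 2 * 𝟙 (hi ≤? p) + 𝟙 (lo ≤? p) * 𝟙 (h ≤? hi)
  ≡ 𝟙 (lo ≤? p) + 𝟙 (hi ≤? p)
left-window lo hi p h lo<hi p<h with lo ≤? p
... | no lo≰p rewrite 𝟙-no (hi ≤? p) (λ hi≤p → lo≰p (≤-trans (<⇒≤ lo<hi) hi≤p)) = refl
... | yes _ with hi ≤? p
...   | yes hi≤p rewrite 𝟙-no (p <? hi) (λ p<hi → <-irrefl refl (<-≤-trans p<hi hi≤p))
                       | 𝟙-no (h ≤? hi) (λ h≤hi → <-irrefl refl (<-≤-trans p<h (≤-trans h≤hi hi≤p))) = refl
...   | no hi≰p rewrite 𝟙-yes (p <? hi) (≰⇒> hi≰p) with hi <? h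
...     | yes hi<h rewrite 𝟙-no (h ≤? hi) (λ h≤hi → <-irrefl refl (<-≤-trans hi<h h≤hi)) = refl
...     | no hi≮h rewrite 𝟙-yes (h ≤? hi) (≮⇒≥ hi≮h) = refl

right-window : ∀ lo hi p h → lo < hi → p < h →
  𝟙 (p <? lo) * (𝟙 (lo <? h) * 𝟙 (h ≤? hi)) + 2 * 𝟙 (h ≤? lo) + 𝟙 (lo ≤? p) * 𝟙 (h ≤? hi)
  ≡ 𝟙 (h ≤? lo) + 𝟙 (h ≤? hi)
right-window lo hi p h lo<hi p<h with lo ≤? p
... | yes lo≤p rewrite 𝟙-no (p <? lo) (λ p<lo → <-irrefl refl (<-≤-trans p<lo lo≤p))
                     | 𝟙-no (h ≤? lo) (λ h≤lo → <-irrefl refl (<-≤-trans p<h (≤-trans h≤lo lo≤p)))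
                     with h ≤? hi
...   | yes _ = refl
...   | no _  = refl
right-window lo hi p h lo<hi p<h | no lo≰p rewrite 𝟙-yes (p <? lo) (≰⇒> lo≰p) with h ≤? lo
...   | yes h≤lo rewrite 𝟙-no (lo <? h) (λ lo<h → <-irrefl refl (<-≤-trans lo<h h≤lo))
                       | 𝟙-yes (h ≤? hi) (≤-trans h≤lo (<⇒≤ lo<hi)) = refl
...   | no h≰lo rewrite 𝟙-yes (lo <? h) (≰⇒> h≰lo) with h ≤? hi
...     | yes _ = refl
...     | no _  = refl

halve : ∀ x y z → x + 2 * y ≡ 2 * z → x / 2 + y ≡ z
halve x y z e = begin
  x / 2 + y              ≡⟨ cong (λ w → w / 2 + y) x≡ ⟩
  (z ∸ y) * 2 / 2 + y    ≡⟨ cong (_+ y) (m*n/n≡m (z ∸ y) 2) ⟩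
  z ∸ y + y              ≡⟨ m∸n+n≡m y≤z ⟩
  z                      ∎
  where
  open ≡-Reasoning
  y≤z : y ≤ z
  y≤z = *-cancelˡ-≤ 2 (≤-trans (m≤n+m (2 * y) x) (≤-reflexive e))
  x≡ : x ≡ (z ∸ y) * 2
  x≡ = trans (sym (m+n∸n≡m x (2 * y))) (trans (cong (_∸ 2 * y) e) (trans (sym (*-distribˡ-∸ 2 z y)) (*-comm 2 (z ∸ y))))

-- For the classes L, S, R
-- the letters l•, r•, i•, o•, e• stand for the class sums of nLeft, nRight,
-- nInner, opened and excess, m for the sum of min(nLeft, nRight) over S, and N•
-- for the class sizes.  The hypotheses are the summed class identities (h₁–h₅),
-- the double count of disjoint pairs (h₆), the count of the arches left of
-- R-arches (h₇), the pair counts inside L and inside R (h₈, h₉) and the balance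
-- N_L = N_R (h₁₀).  The conclusion, doubled, is the linear combination
-- −2h₁ + 2h₄ − 2h₅ + 2h₆ + 2h₇ − h₈ − h₉ of the hypotheses.
class-bookkeeping : ∀ lL lS lR rL rS rR iL iR oL oS oR eL eS eR m NL NR →
  (h₁ : oL + lL ≡ rL + iL) (h₂ : eL ≡ 0) (h₃ : oR ≡ 0) (h₄ : eR + (NR + (rR + iR)) ≡ lR)
  (h₅ : oS + 2 * m ≡ eS + 2 * rS) (h₆ : lL + lS + lR ≡ rL + rS + rR) (h₇ : lR ≡ NL * NR + rS + rR)
  (h₈ : 2 * lL + 2 * iL + NL ≡ NL * NL) (h₉ : 2 * rR + 2 * iR + NR ≡ NR * NR) (h₁₀ : NL ≡ NR) →
  (lL + lS + lR) + (eL + eS + eR) ≡ (oL + oS + oR) + 2 * (lL + rR + m)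
class-bookkeeping lL lS lR rL rS rR iL iR oL oS .0 .0 eS eR m N .N h₁ refl refl h₄ h₅ h₆ h₇ h₈ h₉ refl =
  *-cancelˡ-≡ _ _ 2 (+-cancelʳ-≡ E _ _ (begin
    2 * ((lL + lS + lR) + (0 + eS + eR)) + E
      ≡⟨ cong (2 * ((lL + lS + lR) + (0 + eS + eR)) +_) (sym (combine h₁ (sym h₄) h₅ (sym h₆) (sym h₇) h₈ h₉)) ⟩
    2 * ((lL + lS + lR) + (0 + eS + eR)) + E′
      ≡⟨ identity lL lS lR rL rS rR iL iR oL oS eS eR m N ⟩
    2 * ((oL + oS + 0) + 2 * (lL + rR + m)) + E ∎))
  where
  open ≡-Reasoning
  combo : ℕ → ℕ → ℕ → ℕ → ℕ → ℕ → ℕ → ℕ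
  combo a b c d e f g = 2 * a + 2 * b + 2 * c + 2 * d + 2 * e + f + g
  combine : ∀ {a a′ b b′ c c′ d d′ e e′ f f′ g g′} → a ≡ a′ → b ≡ b′ → c ≡ c′ → d ≡ d′ → e ≡ e′ → f ≡ f′ → g ≡ g′ →
    combo a b c d e f g ≡ combo a′ b′ c′ d′ e′ f′ g′
  combine refl refl refl refl refl refl refl = refl
  E E′ : ℕ
  E′ = combo (oL + lL) lR (oS + 2 * m) (rL + rS + rR) (N * N + rS + rR) (2 * lL + 2 * iL + N) (2 * rR + 2 * iR + N)
  E  = combo (rL + iL) (eR + (N + (rR + iR))) (eS + 2 * rS) (lL + lS + lR) lR (N * N) (N * N)
  identity : ∀ lL lS lR rL rS rR iL iR oL oS eS eR m N →
    2 * ((lL + lS + lR) + (0 + eS + eR))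
      + (2 * (oL + lL) + 2 * lR + 2 * (oS + 2 * m) + 2 * (rL + rS + rR) + 2 * (N * N + rS + rR)
         + (2 * lL + 2 * iL + N) + (2 * rR + 2 * iR + N))
    ≡ 2 * ((oL + oS + 0) + 2 * (lL + rR + m))
      + (2 * (rL + iL) + 2 * (eR + (N + (rR + iR))) + 2 * (eS + 2 * rS) + 2 * (lL + lS + lR) + 2 * lR
         + N * N + N * N)
  identity = solve-∀

module Matching {n : ℕ} (π : NCMatching n) where

  As : List Arch
  As = arches π

  lo hi : Arch → ℕ
  lo = proj₁
  hi = proj₂

  lo<hi : ∀ {α} → α ∈ As → lo α < hi α
  lo<hi = All.lookup (ordered π)

  no-crossing : ∀ {α β} → α ∈ As → β ∈ As → ¬ Crossing α β
  no-crossing α∈ β∈ = All.lookup (All.lookup (noncrossing π) α∈) β∈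

  -- The basic counting principle: the endpoints are exactly the positions 1, …, 2n,
  -- so a sum over positions is a sum over the two endpoints of every arch.
  ∑-positions : (g : ℕ → ℕ) → ∑[ α ∈ As ] (g (lo α) + g (hi α)) ≡ ∑ (range1 (2 * n)) g
  ∑-positions g = trans (sym (∑-endpoints As g)) (∑-↭ (perfect π) g)

  opensAt closesAt : ℕ → ℕ
  opensAt  x = ∑[ γ ∈ As ] 𝟙 (lo γ ≟ x)
  closesAt x = ∑[ γ ∈ As ] 𝟙 (hi γ ≟ x)

  endpoint-multiplicity : ∀ x → opensAt x + closesAt x ≡ 𝟙 ((1 ≤? x) ×-dec (x ≤? 2 * n))
  endpoint-multiplicity x = trans (sym (∑-+ As _ _)) (trans (∑-positions (λ y → 𝟙 (y ≟ x))) (count-≡ (2 * n) x))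

  at-most-one-endpoint : ∀ x → opensAt x + closesAt x ≤ 1
  at-most-one-endpoint x = ≤-trans (≤-reflexive (endpoint-multiplicity x)) (𝟙-≤1 _)

  opensAt-lo : ∀ {α} → α ∈ As → 1 ≤ opensAt (lo α)
  opensAt-lo {α} α∈ = ≤-trans (≤-reflexive (sym (𝟙-yes (lo α ≟ lo α) refl))) (∑-member As _ α∈)

  closesAt-hi : ∀ {α} → α ∈ As → 1 ≤ closesAt (hi α)
  closesAt-hi {α} α∈ = ≤-trans (≤-reflexive (sym (𝟙-yes (hi α ≟ hi α) refl))) (∑-member As _ α∈)

  opensAt-lo≡1 : ∀ {α} → α ∈ As → opensAt (lo α) ≡ 1
  opensAt-lo≡1 {α} α∈ = ≤-antisym (≤-trans (m≤m+n _ _) (at-most-one-endpoint (lo α))) (opensAt-lo α∈)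

  lo-range : ∀ {α} → α ∈ As → (1 ≤ lo α) × (lo α ≤ 2 * n)
  lo-range {α} α∈ = 𝟙-witness _ (≤-trans (opensAt-lo α∈)
    (≤-trans (m≤m+n _ _) (≤-reflexive (endpoint-multiplicity (lo α)))))

  hi-range : ∀ {α} → α ∈ As → (1 ≤ hi α) × (hi α ≤ 2 * n)
  hi-range {α} α∈ = 𝟙-witness _ (≤-trans (closesAt-hi α∈)
    (≤-trans (m≤n+m _ _) (≤-reflexive (endpoint-multiplicity (hi α)))))

  lo≢hi : ∀ {α β} → α ∈ As → β ∈ As → lo α ≢ hi β
  lo≢hi {α} α∈ β∈ e = <-irrefl refl (≤-trans
    (+-mono-≤ (opensAt-lo α∈) (subst (λ z → 1 ≤ closesAt z) (sym e) (closesAt-hi β∈)))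
    (at-most-one-endpoint (lo α)))

  lo-injective : ∀ {α β} → α ∈ As → β ∈ As → lo α ≡ lo β → α ≡ β
  lo-injective {α} {β} α∈ β∈ e with ≡-dec _≟_ _≟_ α β
  ... | yes α≡β = α≡β
  ... | no α≢β  = ⊥-elim (<-irrefl refl (≤-trans twice (≤-trans (m≤m+n _ _) (at-most-one-endpoint (lo α)))))
    where
    twice : 2 ≤ opensAt (lo α)
    twice = ≤-trans (≤-reflexive (cong₂ _+_ (sym (𝟙-yes (lo α ≟ lo α) refl)) (sym (𝟙-yes (lo β ≟ lo α) (sym e)))))
                    (∑-two-members As _ α∈ β∈ α≢β)

  hi-injective : ∀ {α β} → α ∈ As → β ∈ As → hi α ≡ hi β → α ≡ β
  hi-injective {α} {β} α∈ β∈ e with ≡-dec _≟_ _≟_ α β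
  ... | yes α≡β = α≡β
  ... | no α≢β  = ⊥-elim (<-irrefl refl (≤-trans twice (≤-trans (m≤n+m _ _) (at-most-one-endpoint (hi α)))))
    where
    twice : 2 ≤ closesAt (hi α)
    twice = ≤-trans (≤-reflexive (cong₂ _+_ (sym (𝟙-yes (hi α ≟ hi α) refl)) (sym (𝟙-yes (hi β ≟ hi α) (sym e)))))
                    (∑-two-members As _ α∈ β∈ α≢β)

  -- There are 2n endpoints, two per arch.
  arch-count : length As ≡ n
  arch-count = *-cancelˡ-≡ (length As) n 2 (begin
    2 * length As            ≡⟨ cong (2 *_) (sym (∑-one As)) ⟩
    2 * ∑[ α ∈ As ] 1        ≡⟨ sym (∑-*ˡ As 2 (λ _ → 1)) ⟩
    ∑[ α ∈ As ] 2            ≡⟨ ∑-positions (λ _ → 1) ⟩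
    ∑[ x ∈ range1 (2 * n) ] 1 ≡⟨ trans (∑-one (range1 (2 * n))) (length-range1 (2 * n)) ⟩
    2 * n                    ∎)
    where open ≡-Reasoning

  before : Arch → Arch → ℕ
  before β α = 𝟙 (hi β <? lo α)

  -- encloses β α = 1 when β passes over the left endpoint of α, i.e. (for arches
  -- of π) when β encloses α.
  encloses : Arch → Arch → ℕ
  encloses β α = 𝟙 ((lo β <? lo α) ×-dec (lo α <? hi β))

  nLeft nRight nOuter nInner : Arch → ℕ
  nLeft  α = ∑[ β ∈ As ] before β α
  nRight α = ∑[ β ∈ As ] before α β
  nOuter α = ∑[ β ∈ As ] encloses β α
  nInner α = ∑[ β ∈ As ] encloses α β

  private
    sum5 : ∀ {a b c d e a′ b′ c′ d′ e′ : ℕ} → a ≡ a′ → b ≡ b′ → c ≡ c′ → d ≡ d′ → e ≡ e′ →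
      a + b + c + d + e ≡ a′ + b′ + c′ + d′ + e′
    sum5 refl refl refl refl refl = refl

  pair-trichotomy : ∀ {α β} → α ∈ As → β ∈ As →
    before β α + before α β + encloses β α + encloses α β + 𝟙 (lo β ≟ lo α) ≡ 1
  pair-trichotomy {α} {β} α∈ β∈ with <-cmp (lo β) (lo α)
  ... | tri≈ _ lβ≡lα _ with lo-injective β∈ α∈ lβ≡lα
  ...   | refl = sum5 (𝟙-no (hi α <? lo α) (<-asym (lo<hi α∈))) (𝟙-no (hi α <? lo α) (<-asym (lo<hi α∈)))
                      (𝟙-no ((lo α <? lo α) ×-dec _) (λ (l<l , _) → <-irrefl refl l<l))
                      (𝟙-no ((lo α <? lo α) ×-dec _) (λ (l<l , _) → <-irrefl refl l<l))
                      (𝟙-yes (lo α ≟ lo α) refl)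
  pair-trichotomy {α} {β} α∈ β∈ | tri< lβ<lα _ _ with <-cmp (hi β) (lo α)
  ... | tri< hβ<lα _ _ = sum5 (𝟙-yes (hi β <? lo α) hβ<lα) (𝟙-no (hi α <? lo β) (<-asym (<-trans lβ<lα (lo<hi α∈))))
                              (𝟙-no ((lo β <? lo α) ×-dec _) (λ (_ , lα<hβ) → <-asym lα<hβ hβ<lα))
                              (𝟙-no ((lo α <? lo β) ×-dec _) (λ (lα<lβ , _) → <-asym lα<lβ lβ<lα))
                              (𝟙-no (lo β ≟ lo α) (λ e → <-irrefl e lβ<lα))
  ... | tri≈ _ hβ≡lα _ = ⊥-elim (lo≢hi α∈ β∈ (sym hβ≡lα))
  ... | tri> _ _ lα<hβ = sum5 (𝟙-no (hi β <? lo α) (<-asym lα<hβ)) (𝟙-no (hi α <? lo β) (<-asym (<-trans lβ<lα (lo<hi α∈))))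
                              (𝟙-yes ((lo β <? lo α) ×-dec (lo α <? hi β)) (lβ<lα , lα<hβ))
                              (𝟙-no ((lo α <? lo β) ×-dec _) (λ (lα<lβ , _) → <-asym lα<lβ lβ<lα))
                              (𝟙-no (lo β ≟ lo α) (λ e → <-irrefl e lβ<lα))
  pair-trichotomy {α} {β} α∈ β∈ | tri> _ _ lα<lβ with <-cmp (hi α) (lo β)
  ... | tri< hα<lβ _ _ = sum5 (𝟙-no (hi β <? lo α) (<-asym (<-trans lα<lβ (lo<hi β∈)))) (𝟙-yes (hi α <? lo β) hα<lβ)
                              (𝟙-no ((lo β <? lo α) ×-dec _) (λ (lβ<lα , _) → <-asym lβ<lα lα<lβ))
                              (𝟙-no ((lo α <? lo β) ×-dec _) (λ (_ , lβ<hα) → <-asym lβ<hα hα<lβ))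
                              (𝟙-no (lo β ≟ lo α) (λ e → <-irrefl (sym e) lα<lβ))
  ... | tri≈ _ hα≡lβ _ = ⊥-elim (lo≢hi β∈ α∈ (sym hα≡lβ))
  ... | tri> _ _ lβ<hα = sum5 (𝟙-no (hi β <? lo α) (<-asym (<-trans lα<lβ (lo<hi β∈)))) (𝟙-no (hi α <? lo β) (<-asym lβ<hα))
                              (𝟙-no ((lo β <? lo α) ×-dec _) (λ (lβ<lα , _) → <-asym lβ<lα lα<lβ))
                              (𝟙-yes ((lo α <? lo β) ×-dec (lo β <? hi α)) (lα<lβ , lβ<hα))
                              (𝟙-no (lo β ≟ lo α) (λ e → <-irrefl (sym e) lα<lβ))

  neighbourhood : ∀ {α} → α ∈ As → nLeft α + nRight α + nOuter α + nInner α + 1 ≡ n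
  neighbourhood {α} α∈ = begin
    nLeft α + nRight α + nOuter α + nInner α + 1
      ≡⟨ cong (nLeft α + nRight α + nOuter α + nInner α +_) (sym (opensAt-lo≡1 α∈)) ⟩
    nLeft α + nRight α + nOuter α + nInner α + opensAt (lo α)
      ≡⟨ sym split ⟩
    ∑[ β ∈ As ] (before β α + before α β + encloses β α + encloses α β + 𝟙 (lo β ≟ lo α))
      ≡⟨ ∑-cong As (pair-trichotomy α∈) ⟩
    ∑[ β ∈ As ] 1
      ≡⟨ trans (∑-one As) arch-count ⟩
    n ∎
    where
    open ≡-Reasoning
    split : ∑[ β ∈ As ] (before β α + before α β + encloses β α + encloses α β + 𝟙 (lo β ≟ lo α))
            ≡ nLeft α + nRight α + nOuter α + nInner α + opensAt (lo α)
    split = trans (∑-+ As _ _) (cong (_+ opensAt (lo α)) (trans (∑-+ As _ _)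
              (cong (_+ nInner α) (trans (∑-+ As _ _) (cong (_+ nOuter α) (∑-+ As _ _))))))

  -- The positions before lo α: two for each arch on the left, one for each arch around.
  lo-formula : ∀ {α} → α ∈ As → lo α ≡ suc (2 * nLeft α + nOuter α)
  lo-formula {α} α∈ = trans (sym (suc[∸1] (proj₁ (lo-range α∈)))) (cong suc (begin
    lo α ∸ 1                                           ≡⟨ sym (m≥n⇒m⊓n≡n (≤-trans (m∸n≤m (lo α) 1) (proj₂ (lo-range α∈)))) ⟩
    2 * n ⊓ (lo α ∸ 1)                                 ≡⟨ sym (count-< (2 * n) (lo α)) ⟩
    ∑[ x ∈ range1 (2 * n) ] 𝟙 (x <? lo α)              ≡⟨ sym (∑-positions (λ x → 𝟙 (x <? lo α))) ⟩
    ∑[ β ∈ As ] (𝟙 (lo β <? lo α) + 𝟙 (hi β <? lo α))  ≡⟨ ∑-cong As before-or-around ⟩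
    ∑[ β ∈ As ] (2 * before β α + encloses β α)        ≡⟨ ∑-+ As _ _ ⟩
    ∑[ β ∈ As ] (2 * before β α) + nOuter α            ≡⟨ cong (_+ nOuter α) (∑-*ˡ As 2 (λ β → before β α)) ⟩
    2 * nLeft α + nOuter α                             ∎))
    where
    open ≡-Reasoning
    before-or-around : ∀ {β} → β ∈ As → 𝟙 (lo β <? lo α) + 𝟙 (hi β <? lo α) ≡ 2 * before β α + encloses β α
    before-or-around {β} β∈ with <-cmp (hi β) (lo α)
    ... | tri< hβ<lα _ _ = trans (cong₂ _+_ (𝟙-yes (lo β <? lo α) (<-trans (lo<hi β∈) hβ<lα)) (𝟙-yes (hi β <? lo α) hβ<lα))
                                 (sym (cong₂ (λ b e → 2 * b + e) (𝟙-yes (hi β <? lo α) hβ<lα)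
                                        (𝟙-no ((lo β <? lo α) ×-dec _) (λ (_ , lα<hβ) → <-asym lα<hβ hβ<lα))))
    ... | tri≈ _ hβ≡lα _ = ⊥-elim (lo≢hi α∈ β∈ (sym hβ≡lα))
    ... | tri> _ _ lα<hβ = trans (cong (𝟙 (lo β <? lo α) +_) (𝟙-no (hi β <? lo α) (<-asym lα<hβ)))
                                 (trans (+-identityʳ _)
                                 (trans (𝟙-iff (lo β <? lo α) ((lo β <? lo α) ×-dec (lo α <? hi β)) (_, lα<hβ) proj₁)
                                 (cong (λ b → 2 * b + encloses β α) (sym (𝟙-no (hi β <? lo α) (<-asym lα<hβ))))))

  -- The positions after hi α: two for each arch on the right, one for each arch
  -- around (here noncrossing is used: an arch around lo α also passes over hi α).
  hi-formula : ∀ {α} → α ∈ As → hi α + (2 * nRight α + nOuter α) ≡ 2 * n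
  hi-formula {α} α∈ = suc-injective (begin
    suc (hi α + (2 * nRight α + nOuter α))           ≡⟨ cong suc (+-comm (hi α) _) ⟩
    suc (2 * nRight α + nOuter α + hi α)             ≡⟨ sym (+-suc _ (hi α)) ⟩
    2 * nRight α + nOuter α + suc (hi α)             ≡⟨ cong (_+ suc (hi α)) (sym after) ⟩
    ∑[ x ∈ range1 (2 * n) ] 𝟙 (hi α <? x) + suc (hi α)
      ≡⟨ count-≥ (2 * n) (suc (hi α)) (s≤s z≤n) (s≤s (proj₂ (hi-range α∈))) ⟩
    suc (2 * n)                                      ∎)
    where
    open ≡-Reasoning
    after-or-around : ∀ {β} → β ∈ As → 𝟙 (hi α <? lo β) + 𝟙 (hi α <? hi β) ≡ 2 * before α β + encloses β α
    after-or-around {β} β∈ with <-cmp (hi α) (lo β)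
    ... | tri< hα<lβ _ _ = trans (cong₂ _+_ (𝟙-yes (hi α <? lo β) hα<lβ) (𝟙-yes (hi α <? hi β) (<-trans hα<lβ (lo<hi β∈))))
                                 (sym (cong₂ (λ b e → 2 * b + e) (𝟙-yes (hi α <? lo β) hα<lβ)
                                        (𝟙-no ((lo β <? lo α) ×-dec _) (λ (lβ<lα , _) → <-asym lβ<lα (<-trans (lo<hi α∈) hα<lβ)))))
    ... | tri≈ _ hα≡lβ _ = ⊥-elim (lo≢hi β∈ α∈ (sym hα≡lβ))
    ... | tri> _ _ lβ<hα = trans (cong (_+ 𝟙 (hi α <? hi β)) (𝟙-no (hi α <? lo β) (<-asym lβ<hα)))
                                 (trans (𝟙-iff (hi α <? hi β) ((lo β <? lo α) ×-dec (lo α <? hi β)) around outside)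
                                 (cong (λ b → 2 * b + encloses β α) (sym (𝟙-no (hi α <? lo β) (<-asym lβ<hα)))))
      where
      around : hi α < hi β → lo β < lo α × lo α < hi β
      around hα<hβ with <-cmp (lo α) (lo β)
      ... | tri< lα<lβ _ _ = ⊥-elim (no-crossing α∈ β∈ (lα<lβ , lβ<hα , hα<hβ))
      ... | tri≈ _ lα≡lβ _ = ⊥-elim (<-irrefl (cong hi (lo-injective α∈ β∈ lα≡lβ)) hα<hβ)
      ... | tri> _ _ lβ<lα = lβ<lα , <-trans (lo<hi α∈) hα<hβ
      outside : lo β < lo α × lo α < hi β → hi α < hi β
      outside (lβ<lα , lα<hβ) with <-cmp (hi α) (hi β)
      ... | tri< hα<hβ _ _ = hα<hβ
      ... | tri≈ _ hα≡hβ _ = ⊥-elim (<-irrefl (cong lo (hi-injective β∈ α∈ (sym hα≡hβ))) lβ<lα)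
      ... | tri> _ _ hβ<hα = ⊥-elim (no-crossing β∈ α∈ (lβ<lα , lα<hβ , hβ<hα))
    after : ∑[ x ∈ range1 (2 * n) ] 𝟙 (hi α <? x) ≡ 2 * nRight α + nOuter α
    after = begin
      ∑[ x ∈ range1 (2 * n) ] 𝟙 (hi α <? x)              ≡⟨ sym (∑-positions (λ x → 𝟙 (hi α <? x))) ⟩
      ∑[ β ∈ As ] (𝟙 (hi α <? lo β) + 𝟙 (hi α <? hi β))  ≡⟨ ∑-cong As after-or-around ⟩
      ∑[ β ∈ As ] (2 * before α β + encloses β α)        ≡⟨ ∑-+ As _ _ ⟩
      ∑[ β ∈ As ] (2 * before α β) + nOuter α            ≡⟨ cong (_+ nOuter α) (∑-*ˡ As 2 (before α)) ⟩
      2 * nRight α + nOuter α                            ∎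

  isOpener? : (x : ℕ) → Dec (Any (λ γ → lo γ ≡ x) As)
  isOpener? x = any? (λ γ → lo γ ≟ x) As

  ∑-openers : (g : ℕ → ℕ) → ∑[ x ∈ range1 (2 * n) ] (𝟙 (isOpener? x) * g x) ≡ ∑[ α ∈ As ] g (lo α)
  ∑-openers g = trans (sym (∑-positions (λ x → 𝟙 (isOpener? x) * g x))) (∑-cong As only-lo)
    where
    only-lo : ∀ {α} → α ∈ As → 𝟙 (isOpener? (lo α)) * g (lo α) + 𝟙 (isOpener? (hi α)) * g (hi α) ≡ g (lo α)
    only-lo {α} α∈ rewrite 𝟙-yes (isOpener? (lo α)) (lose α∈ refl)
                         | 𝟙-no (isOpener? (hi α)) (λ any → let (γ , γ∈ , e) = find any in lo≢hi γ∈ α∈ e)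
      = trans (+-identityʳ _) (+-identityʳ _)

  openedBefore closedBefore : ℕ → ℕ
  openedBefore x = ∑[ β ∈ As ] 𝟙 (lo β <? x)
  closedBefore x = ∑[ β ∈ As ] 𝟙 (hi β <? x)

  -- The position x is preceded by x − 1 positions, each opening or closing an arch.
  x∸1≡opened+closed : ∀ x → x ≤ 2 * n → x ∸ 1 ≡ openedBefore x + closedBefore x
  x∸1≡opened+closed x x≤2n = begin
    x ∸ 1                                       ≡⟨ sym (m≥n⇒m⊓n≡n (≤-trans (m∸n≤m x 1) x≤2n)) ⟩
    2 * n ⊓ (x ∸ 1)                             ≡⟨ sym (count-< (2 * n) x) ⟩
    ∑[ y ∈ range1 (2 * n) ] 𝟙 (y <? x)          ≡⟨ sym (∑-positions (λ y → 𝟙 (y <? x))) ⟩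
    ∑[ β ∈ As ] (𝟙 (lo β <? x) + 𝟙 (hi β <? x)) ≡⟨ ∑-+ As _ _ ⟩
    openedBefore x + closedBefore x             ∎
    where open ≡-Reasoning

  openers-below : ∀ x → x ≤ 2 * n → ∑[ y ∈ range1 (x ∸ 1) ] 𝟙 (isOpener? y) ≡ openedBefore x
  openers-below x x≤2n = begin
    ∑[ y ∈ range1 (x ∸ 1) ] 𝟙 (isOpener? y)
      ≡⟨ cong (λ z → ∑[ y ∈ range1 z ] 𝟙 (isOpener? y)) (sym (m≥n⇒m⊓n≡n (≤-trans (m∸n≤m x 1) x≤2n))) ⟩
    ∑[ y ∈ range1 (2 * n ⊓ (x ∸ 1)) ] 𝟙 (isOpener? y)
      ≡⟨ sym (∑-below (2 * n) x (λ y → 𝟙 (isOpener? y))) ⟩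
    ∑[ y ∈ range1 (2 * n) ] (𝟙 (y <? x) * 𝟙 (isOpener? y))
      ≡⟨ ∑-cong (range1 (2 * n)) (λ {y} _ → *-comm (𝟙 (y <? x)) _) ⟩
    ∑[ y ∈ range1 (2 * n) ] (𝟙 (isOpener? y) * 𝟙 (y <? x))
      ≡⟨ ∑-openers (λ y → 𝟙 (y <? x)) ⟩
    openedBefore x ∎
    where open ≡-Reasoning

  d-formula : d n π ≡ ∑[ α ∈ As ] nLeft α
  d-formula = begin
    sumShift 1 (filter isOpener? (range1 (2 * n)))
      ≡⟨ sumShift-filter isOpener? (2 * n) ⟩
    ∑[ x ∈ range1 (2 * n) ] (𝟙 (isOpener? x) * (x ∸ suc (∑[ y ∈ range1 (x ∸ 1) ] 𝟙 (isOpener? y))))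
      ≡⟨ ∑-range1-cong (2 * n) (λ x _ x≤2n → cong (𝟙 (isOpener? x) *_) (closers x x≤2n)) ⟩
    ∑[ x ∈ range1 (2 * n) ] (𝟙 (isOpener? x) * closedBefore x)
      ≡⟨ ∑-openers closedBefore ⟩
    ∑[ α ∈ As ] nLeft α ∎
    where
    open ≡-Reasoning
    closers : ∀ x → x ≤ 2 * n → x ∸ suc (∑[ y ∈ range1 (x ∸ 1) ] 𝟙 (isOpener? y)) ≡ closedBefore x
    closers x x≤2n = begin
      x ∸ suc (∑[ y ∈ range1 (x ∸ 1) ] 𝟙 (isOpener? y)) ≡⟨ cong (λ z → x ∸ suc z) (openers-below x x≤2n) ⟩
      x ∸ suc (openedBefore x)                          ≡⟨ sym (∸-+-assoc x 1 (openedBefore x)) ⟩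
      x ∸ 1 ∸ openedBefore x                            ≡⟨ cong (_∸ openedBefore x) (x∸1≡opened+closed x x≤2n) ⟩
      openedBefore x + closedBefore x ∸ openedBefore x  ≡⟨ m+n∸m≡n (openedBefore x) (closedBefore x) ⟩
      closedBefore x                                    ∎

  hat-+ : ∀ x → x ≤ 2 * n + 1 → hat n x + x ≡ 2 * n + 1
  hat-+ x x≤ = m∸n+n≡m x≤

  private
    1+n+n : suc n + n ≡ 2 * n + 1
    1+n+n = identity n
      where
      identity : ∀ n → suc n + n ≡ 2 * n + 1
      identity = solve-∀

  n<hat : ∀ {p} → p < n → n < hat n p
  n<hat {p} p<n = m+n≤o⇒m≤o∸n (suc n) (≤-trans (+-monoʳ-≤ (suc n) (<⇒≤ p<n)) (≤-reflexive 1+n+n))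

  p<hat : ∀ {p} → p < n → p < hat n p
  p<hat p<n = <-trans p<n (n<hat p<n)

  p≤2n : ∀ {p} → p < n → p ≤ 2 * n
  p≤2n {p} p<n = ≤-trans (<⇒≤ p<n) (m≤m+n n (n + 0))

  countL-∑ : ∀ p → countL n π p ≡ ∑[ α ∈ As ] (𝟙 (lo α ≤? p) * (𝟙 (p <? hi α) * 𝟙 (hi α <? hat n p)))
  countL-∑ p = trans (length-filter≡∑ _ As) (∑-cong As (λ {α} _ →
    trans (𝟙-× (lo α ≤? p) _) (cong (𝟙 (lo α ≤? p) *_) (𝟙-× (p <? hi α) _))))

  countR-∑ : ∀ p → countR n π p ≡ ∑[ α ∈ As ] (𝟙 (p <? lo α) * (𝟙 (lo α <? hat n p) * 𝟙 (hat n p ≤? hi α)))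
  countR-∑ p = trans (length-filter≡∑ _ As) (∑-cong As (λ {α} _ →
    trans (𝟙-× (p <? lo α) _) (cong (𝟙 (p <? lo α) *_) (𝟙-× (lo α <? hat n p) _))))

  -- The arches correcting #{lo ≤ p} to m_p: those opened at or after p̂, and
  -- those with lo ≤ p < p̂ ≤ hi.
  excessAt : ℕ → Arch → ℕ
  excessAt p α = 𝟙 (hat n p ≤? lo α) + 𝟙 (lo α ≤? p) * 𝟙 (hat n p ≤? hi α)

  private
    ∑-a+2b+c : (a b c : Arch → ℕ) → ∑[ α ∈ As ] (a α + 2 * b α + c α) ≡ ∑ As a + 2 * ∑ As b + ∑ As c
    ∑-a+2b+c a b c = trans (∑-+ As _ c) (cong (_+ ∑ As c) (trans (∑-+ As a _) (cong (∑ As a +_) (∑-*ˡ As 2 b))))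

    mp-arith : ∀ cL cR W W′ E A → cL + 2 * W + E ≡ A + W → cR + 2 * W′ + E ≡ A + W → (cL + cR) / 2 + (W′ + E) ≡ A
    mp-arith cL cR W W′ E A left right = halve (cL + cR) (W′ + E) A (+-cancelʳ-≡ (2 * W) _ _ (begin
      cL + cR + 2 * (W′ + E) + 2 * W            ≡⟨ regroup cL cR W W′ E ⟩
      (cL + 2 * W + E) + (cR + 2 * W′ + E)      ≡⟨ cong₂ _+_ left right ⟩
      (A + W) + (A + W)                         ≡⟨ double A W ⟩
      2 * A + 2 * W                             ∎))
      where
      open ≡-Reasoning
      regroup : ∀ cL cR W W′ E → cL + cR + 2 * (W′ + E) + 2 * W ≡ (cL + 2 * W + E) + (cR + 2 * W′ + E)
      regroup = solve-∀
      double : ∀ A W → (A + W) + (A + W) ≡ 2 * A + 2 * W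
      double = solve-∀

  -- m_p = #{lo ≤ p} − Σ_α excessAt p α for p < n: |A^L_p| and |A^R_p| are read
  -- off from how the arches meet the p positions of [1, p], resp. of [p̂, 2n].
  mp-formula : ∀ {p} → p < n → mp n π p + ∑[ α ∈ As ] excessAt p α ≡ ∑[ α ∈ As ] 𝟙 (lo α ≤? p)
  mp-formula {p} p<n = begin
    mp n π p + ∑[ α ∈ As ] excessAt p α  ≡⟨ cong (mp n π p +_) (∑-+ As _ _) ⟩
    (countL n π p + countR n π p) / 2 + (W′ + E)
      ≡⟨ mp-arith (countL n π p) (countR n π p) W W′ E A left right ⟩
    A ∎
    where
    open ≡-Reasoning
    h = hat n p
    A W W′ E H : ℕ
    A  = ∑[ α ∈ As ] 𝟙 (lo α ≤? p)
    W  = ∑[ α ∈ As ] 𝟙 (hi α ≤? p)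
    W′ = ∑[ α ∈ As ] 𝟙 (h ≤? lo α)
    H  = ∑[ α ∈ As ] 𝟙 (h ≤? hi α)
    E  = ∑[ α ∈ As ] (𝟙 (lo α ≤? p) * 𝟙 (h ≤? hi α))
    initial : A + W ≡ p
    initial = trans (sym (∑-+ As _ _)) (trans (∑-positions (λ x → 𝟙 (x ≤? p)))
                (trans (count-≤ (2 * n) p) (m≥n⇒m⊓n≡n (p≤2n p<n))))
    final : W′ + H ≡ p
    final = +-cancelʳ-≡ h _ _ (begin
      W′ + H + h                                  ≡⟨ cong (_+ h) (trans (sym (∑-+ As _ _)) (∑-positions (λ x → 𝟙 (h ≤? x)))) ⟩
      ∑[ x ∈ range1 (2 * n) ] 𝟙 (h ≤? x) + h      ≡⟨ count-≥ (2 * n) h (≤-trans (s≤s z≤n) (p<hat p<n)) h≤1+2n ⟩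
      suc (2 * n)                                 ≡⟨ +-comm 1 (2 * n) ⟩
      2 * n + 1                                   ≡⟨ sym (hat-+ p p≤) ⟩
      h + p                                       ≡⟨ +-comm h p ⟩
      p + h                                       ∎)
      where
      p≤ : p ≤ 2 * n + 1
      p≤ = ≤-trans (p≤2n p<n) (m≤m+n (2 * n) 1)
      h≤1+2n : h ≤ suc (2 * n)
      h≤1+2n = ≤-trans (m∸n≤m (2 * n + 1) p) (≤-reflexive (+-comm (2 * n) 1))
    left : countL n π p + 2 * W + E ≡ A + W
    left = begin
      countL n π p + 2 * W + E  ≡⟨ cong (λ z → z + 2 * W + E) (countL-∑ p) ⟩
      _                         ≡⟨ sym (∑-a+2b+c _ _ _) ⟩
      _                         ≡⟨ ∑-cong As (λ {α} α∈ → left-window (lo α) (hi α) p h (lo<hi α∈) (p<hat p<n)) ⟩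
      _                         ≡⟨ ∑-+ As _ _ ⟩
      A + W                     ∎
    right : countR n π p + 2 * W′ + E ≡ A + W
    right = begin
      countR n π p + 2 * W′ + E  ≡⟨ cong (λ z → z + 2 * W′ + E) (countR-∑ p) ⟩
      _                          ≡⟨ sym (∑-a+2b+c _ _ _) ⟩
      _                          ≡⟨ ∑-cong As (λ {α} α∈ → right-window (lo α) (hi α) p h (lo<hi α∈) (p<hat p<n)) ⟩
      _                          ≡⟨ ∑-+ As _ _ ⟩
      W′ + H                     ≡⟨ trans final (sym initial) ⟩
      A + W                      ∎

  opened excess : Arch → ℕ
  opened α = ∑[ p ∈ range1 (n ∸ 1) ] 𝟙 (lo α ≤? p)
  excess α = ∑[ p ∈ range1 (n ∸ 1) ] excessAt p α

  sumM-formula : sumM n π + ∑[ α ∈ As ] excess α ≡ ∑[ α ∈ As ] opened α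
  sumM-formula = begin
    sumM n π + ∑[ α ∈ As ] excess α
      ≡⟨ cong₂ _+_ (∑-map (range1 (n ∸ 1)) (mp n π)) (∑-swap As (range1 (n ∸ 1)) (λ α p → excessAt p α)) ⟩
    ∑ (range1 (n ∸ 1)) (mp n π) + ∑[ p ∈ range1 (n ∸ 1) ] ∑[ α ∈ As ] excessAt p α
      ≡⟨ sym (∑-+ (range1 (n ∸ 1)) _ _) ⟩
    ∑[ p ∈ range1 (n ∸ 1) ] (mp n π p + ∑[ α ∈ As ] excessAt p α)
      ≡⟨ ∑-range1-cong (n ∸ 1) (λ p 1≤p p≤n∸1 → mp-formula (≤∸1⇒< 1≤p p≤n∸1)) ⟩
    ∑[ p ∈ range1 (n ∸ 1) ] ∑[ α ∈ As ] 𝟙 (lo α ≤? p)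
      ≡⟨ ∑-swap (range1 (n ∸ 1)) As (λ p α → 𝟙 (lo α ≤? p)) ⟩
    ∑[ α ∈ As ] opened α ∎
    where open ≡-Reasoning

  InL InS InR : Arch → Set
  InL α = hi α ≤ n
  InS α = lo α ≤ n × n < hi α
  InR α = n < lo α

  inL? : ∀ α → Dec (InL α)
  inL? α = hi α ≤? n

  inS? : ∀ α → Dec (InS α)
  inS? α = (lo α ≤? n) ×-dec (n <? hi α)

  inR? : ∀ α → Dec (InR α)
  inR? α = n <? lo α

  data Class (α : Arch) : Set where
    left   : InL α → Class α
    middle : InS α → Class α
    right  : InR α → Class α

  classify : ∀ α → Class α
  classify α with inL? α | inR? α
  ... | yes αL | _      = left αL
  ... | no _   | yes αR = right αR
  ... | no ¬αL | no ¬αR = middle (≮⇒≥ ¬αR , ≰⇒> ¬αL)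

  L⇒¬S : ∀ {α} → InL α → ¬ InS α
  L⇒¬S αL (_ , n<hi) = <-irrefl refl (<-≤-trans n<hi αL)

  L⇒¬R : ∀ {α} → α ∈ As → InL α → ¬ InR α
  L⇒¬R α∈ αL n<lo = <-irrefl refl (<-≤-trans (<-trans n<lo (lo<hi α∈)) αL)

  S⇒¬R : ∀ {α} → InS α → ¬ InR α
  S⇒¬R (lo≤n , _) n<lo = <-irrefl refl (<-≤-trans n<lo lo≤n)

  hat-flip : ∀ {p x} → p ≤ 2 * n + 1 → x ≤ 2 * n + 1 → hat n p ≤ x → hat n x ≤ p
  hat-flip {p} {x} p≤ x≤ p̂≤x =
    m≤n+o⇒m∸n≤o (2 * n + 1) x (≤-trans (≤-reflexive (sym (m∸n+n≡m p≤))) (+-monoˡ-≤ p p̂≤x))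

  private
    ≤2n+1 : ∀ {x} → x ≤ 2 * n → x ≤ 2 * n + 1
    ≤2n+1 x≤2n = ≤-trans x≤2n (m≤m+n (2 * n) 1)

    n<p̂ : ∀ {p} → 1 ≤ p → p ≤ n ∸ 1 → n < hat n p
    n<p̂ 1≤p p≤n∸1 = n<hat (≤∸1⇒< 1≤p p≤n∸1)

    p≤2n+1 : ∀ {p} → 1 ≤ p → p ≤ n ∸ 1 → p ≤ 2 * n + 1
    p≤2n+1 1≤p p≤n∸1 = ≤2n+1 (p≤2n (≤∸1⇒< 1≤p p≤n∸1))

  count-up-to-n : ∀ c → 1 ≤ c → c ≤ n → ∑[ p ∈ range1 (n ∸ 1) ] 𝟙 (c ≤? p) + c ≡ n
  count-up-to-n c 1≤c c≤n =
    trans (count-≥ (n ∸ 1) c 1≤c (≤-trans c≤n (≤-reflexive (sym 1+[n∸1]≡n)))) 1+[n∸1]≡n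
    where
    1+[n∸1]≡n : suc (n ∸ 1) ≡ n
    1+[n∸1]≡n = suc[∸1] (≤-trans 1≤c c≤n)

  opened-≤n : ∀ {α} → α ∈ As → lo α ≤ n → opened α + lo α ≡ n
  opened-≤n α∈ lo≤n = count-up-to-n _ (proj₁ (lo-range α∈)) lo≤n

  opened-R : ∀ {α} → InR α → opened α ≡ 0
  opened-R {α} n<lo = trans (∑-range1-cong (n ∸ 1) (λ p 1≤p p≤n∸1 →
      𝟙-no (lo α ≤? p) (λ lo≤p → <-irrefl refl (<-trans (<-≤-trans n<lo lo≤p) (≤∸1⇒< 1≤p p≤n∸1)))))
    (∑-zero (range1 (n ∸ 1)))

  excess-L : ∀ {α} → α ∈ As → InL α → excess α ≡ 0
  excess-L {α} α∈ hi≤n = trans (∑-range1-cong (n ∸ 1) (λ p 1≤p p≤n∸1 →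
      cong₂ _+_ (𝟙-no (hat n p ≤? lo α) (λ p̂≤lo → <-irrefl refl (≤-trans (n<p̂ 1≤p p≤n∸1) (≤-trans p̂≤lo (<⇒≤ lo<n)))))
                (trans (cong (𝟙 (lo α ≤? p) *_) (𝟙-no (hat n p ≤? hi α) (λ p̂≤hi → <-irrefl refl (<-≤-trans (n<p̂ 1≤p p≤n∸1) (≤-trans p̂≤hi hi≤n)))))
                       (*-zeroʳ (𝟙 (lo α ≤? p))))))
    (∑-zero (range1 (n ∸ 1)))
    where
    lo<n : lo α < n
    lo<n = <-≤-trans (lo<hi α∈) hi≤n

  -- For an arch on the right, excess counts the p with p̂ ≤ lo, i.e. lô ≤ p.
  excess-R : ∀ {α} → α ∈ As → InR α → excess α + hat n (lo α) ≡ n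
  excess-R {α} α∈ n<lo = trans (cong (_+ hat n (lo α)) (∑-range1-cong (n ∸ 1) reflect))
                               (count-up-to-n (hat n (lo α)) 1≤lô lô≤n)
    where
    lo≤ : lo α ≤ 2 * n + 1
    lo≤ = ≤2n+1 (proj₂ (lo-range α∈))
    reflect : ∀ p → 1 ≤ p → p ≤ n ∸ 1 → excessAt p α ≡ 𝟙 (hat n (lo α) ≤? p)
    reflect p 1≤p p≤n∸1 = begin
      𝟙 (hat n p ≤? lo α) + 𝟙 (lo α ≤? p) * 𝟙 (hat n p ≤? hi α)
        ≡⟨ cong (λ z → 𝟙 (hat n p ≤? lo α) + z * 𝟙 (hat n p ≤? hi α))
                (𝟙-no (lo α ≤? p) (λ lo≤p → <-irrefl refl (<-trans (<-≤-trans n<lo lo≤p) (≤∸1⇒< 1≤p p≤n∸1)))) ⟩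
      𝟙 (hat n p ≤? lo α) + 0
        ≡⟨ +-identityʳ _ ⟩
      𝟙 (hat n p ≤? lo α)
        ≡⟨ 𝟙-iff _ _ (hat-flip (p≤2n+1 1≤p p≤n∸1) lo≤) (hat-flip lo≤ (p≤2n+1 1≤p p≤n∸1)) ⟩
      𝟙 (hat n (lo α) ≤? p) ∎
      where open ≡-Reasoning
    1≤lô : 1 ≤ hat n (lo α)
    1≤lô = m+n≤o⇒m≤o∸n 1 (≤-trans (s≤s (proj₂ (lo-range α∈))) (≤-reflexive (+-comm 1 (2 * n))))
    lô≤n : hat n (lo α) ≤ n
    lô≤n = m≤n+o⇒m∸n≤o (2 * n + 1) (lo α) (≤-trans (≤-reflexive (sym 1+n+n)) (+-monoˡ-≤ n n<lo))

  -- For a straddling arch, excess counts the p with lo ≤ p and p̂ ≤ hi, i.e. hî ≤ p.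
  excess-S : ∀ {α} → α ∈ As → InS α → excess α + (lo α ⊔ hat n (hi α)) ≡ n
  excess-S {α} α∈ (lo≤n , n<hi) = trans (cong (_+ (lo α ⊔ hat n (hi α))) (∑-range1-cong (n ∸ 1) reflect))
                                        (count-up-to-n (lo α ⊔ hat n (hi α)) 1≤c c≤n)
    where
    hi≤ : hi α ≤ 2 * n + 1
    hi≤ = ≤2n+1 (proj₂ (hi-range α∈))
    reflect : ∀ p → 1 ≤ p → p ≤ n ∸ 1 → excessAt p α ≡ 𝟙 ((lo α ⊔ hat n (hi α)) ≤? p)
    reflect p 1≤p p≤n∸1 = begin
      𝟙 (hat n p ≤? lo α) + 𝟙 (lo α ≤? p) * 𝟙 (hat n p ≤? hi α)
        ≡⟨ cong (_+ 𝟙 (lo α ≤? p) * 𝟙 (hat n p ≤? hi α))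
                (𝟙-no (hat n p ≤? lo α) (λ p̂≤lo → <-irrefl refl (<-≤-trans (n<p̂ 1≤p p≤n∸1) (≤-trans p̂≤lo lo≤n)))) ⟩
      𝟙 (lo α ≤? p) * 𝟙 (hat n p ≤? hi α)
        ≡⟨ sym (𝟙-× (lo α ≤? p) (hat n p ≤? hi α)) ⟩
      𝟙 ((lo α ≤? p) ×-dec (hat n p ≤? hi α))
        ≡⟨ 𝟙-iff _ _ (λ (lo≤p , p̂≤hi) → ⊔-lub lo≤p (hat-flip (p≤2n+1 1≤p p≤n∸1) hi≤ p̂≤hi))
                     (λ c≤p → ≤-trans (m≤m⊔n (lo α) _) c≤p ,
                              hat-flip hi≤ (p≤2n+1 1≤p p≤n∸1) (≤-trans (m≤n⊔m (lo α) _) c≤p)) ⟩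
      𝟙 ((lo α ⊔ hat n (hi α)) ≤? p) ∎
      where open ≡-Reasoning
    1≤c : 1 ≤ lo α ⊔ hat n (hi α)
    1≤c = ≤-trans (proj₁ (lo-range α∈)) (m≤m⊔n (lo α) _)
    c≤n : lo α ⊔ hat n (hi α) ≤ n
    c≤n = ⊔-lub lo≤n (m≤n+o⇒m∸n≤o (2 * n + 1) (hi α) (≤-trans (≤-reflexive (sym 1+n+n)) (+-monoˡ-≤ n n<hi)))

  -- The reflected right endpoint: the positions after hi α, plus one.
  hat-hi : ∀ {α} → α ∈ As → hat n (hi α) ≡ suc (2 * nRight α + nOuter α)
  hat-hi {α} α∈ = +-cancelʳ-≡ (hi α) _ _ (begin
    hat n (hi α) + hi α                  ≡⟨ hat-+ (hi α) (≤-trans (proj₂ (hi-range α∈)) (m≤m+n (2 * n) 1)) ⟩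
    2 * n + 1                            ≡⟨ cong (_+ 1) (sym (hi-formula α∈)) ⟩
    hi α + (2 * nRight α + nOuter α) + 1 ≡⟨ rearrange (hi α) (2 * nRight α + nOuter α) ⟩
    suc (2 * nRight α + nOuter α) + hi α ∎)
    where
    open ≡-Reasoning
    rearrange : ∀ h x → h + x + 1 ≡ suc x + h
    rearrange = solve-∀

  identity-L : ∀ {α} → α ∈ As → InL α → opened α + nLeft α ≡ nRight α + nInner α
  identity-L {α} α∈ αL = +-cancelʳ-≡ (suc (L + O)) _ _ (begin
    opened α + L + suc (L + O)   ≡⟨ regroup (opened α) L O ⟩
    opened α + suc (2 * L + O)   ≡⟨ cong (opened α +_) (sym (lo-formula α∈)) ⟩
    opened α + lo α              ≡⟨ opened-≤n α∈ (<⇒≤ (<-≤-trans (lo<hi α∈) αL)) ⟩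
    n                            ≡⟨ sym (neighbourhood α∈) ⟩
    L + R + O + I + 1            ≡⟨ regroup′ L R O I ⟩
    R + I + suc (L + O)          ∎)
    where
    open ≡-Reasoning
    L R O I : ℕ
    L = nLeft α
    R = nRight α
    O = nOuter α
    I = nInner α
    regroup : ∀ a L O → a + L + suc (L + O) ≡ a + suc (2 * L + O)
    regroup = solve-∀
    regroup′ : ∀ L R O I → L + R + O + I + 1 ≡ R + I + suc (L + O)
    regroup′ = solve-∀

  identity-R : ∀ {α} → α ∈ As → InR α → excess α + suc (nRight α + nInner α) ≡ nLeft α
  identity-R {α} α∈ αR = +-cancelʳ-≡ (lô + lo α) _ _ (begin
    excess α + suc (R + I) + (lô + lo α)      ≡⟨ regroup (excess α) lô (lo α) R I ⟩
    excess α + lô + suc (R + I) + lo α        ≡⟨ cong₂ (λ a b → a + suc (R + I) + b) (excess-R α∈ αR) (lo-formula α∈) ⟩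
    n + suc (R + I) + suc (2 * L + O)         ≡⟨ cong (λ m → m + suc (R + I) + suc (2 * L + O)) (sym (neighbourhood α∈)) ⟩
    L + R + O + I + 1 + suc (R + I) + suc (2 * L + O)
                                              ≡⟨ regroup′ L R O I ⟩
    L + (2 * (L + R + O + I + 1) + 1)         ≡⟨ cong (λ m → L + (2 * m + 1)) (neighbourhood α∈) ⟩
    L + (2 * n + 1)                           ≡⟨ cong (L +_) (sym (hat-+ (lo α) (≤-trans (proj₂ (lo-range α∈)) (m≤m+n (2 * n) 1)))) ⟩
    L + (lô + lo α)                           ∎)
    where
    open ≡-Reasoning
    L R O I : ℕ
    L = nLeft α
    R = nRight α
    O = nOuter α
    I = nInner α
    lô : ℕ
    lô = hat n (lo α)
    regroup : ∀ e h l R I → e + suc (R + I) + (h + l) ≡ e + h + suc (R + I) + l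
    regroup = solve-∀
    regroup′ : ∀ L R O I → L + R + O + I + 1 + suc (R + I) + suc (2 * L + O) ≡ L + (2 * (L + R + O + I + 1) + 1)
    regroup′ = solve-∀

  identity-S : ∀ {α} → α ∈ As → InS α → opened α + 2 * (nLeft α ⊓ nRight α) ≡ excess α + 2 * nRight α
  identity-S {α} α∈ αS = by-cases (≤-total L R)
    where
    open ≡-Reasoning
    L R O hî : ℕ
    L  = nLeft α
    R  = nRight α
    O  = nOuter α
    hî = hat n (hi α)
    -- opened α and excess α both count a final segment of [1, n − 1]
    both-count : opened α + lo α ≡ excess α + (lo α ⊔ hî)
    both-count = trans (opened-≤n α∈ (proj₁ αS)) (sym (excess-S α∈ αS))
    regroup : ∀ a L O → a + 2 * L + suc O ≡ a + suc (2 * L + O)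
    regroup = solve-∀
    by-cases : (L ≤ R) ⊎ (R ≤ L) → opened α + 2 * (L ⊓ R) ≡ excess α + 2 * R
    by-cases (inj₁ L≤R) = +-cancelʳ-≡ (suc O) _ _ (begin
      opened α + 2 * (L ⊓ R) + suc O   ≡⟨ cong (λ m → opened α + 2 * m + suc O) (m≤n⇒m⊓n≡m L≤R) ⟩
      opened α + 2 * L + suc O         ≡⟨ regroup (opened α) L O ⟩
      opened α + suc (2 * L + O)       ≡⟨ cong (opened α +_) (sym (lo-formula α∈)) ⟩
      opened α + lo α                  ≡⟨ both-count ⟩
      excess α + (lo α ⊔ hî)           ≡⟨ cong (excess α +_) (m≤n⇒m⊔n≡n lo≤hî) ⟩
      excess α + hî                    ≡⟨ cong (excess α +_) (hat-hi α∈) ⟩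
      excess α + suc (2 * R + O)       ≡⟨ sym (regroup (excess α) R O) ⟩
      excess α + 2 * R + suc O         ∎)
      where
      lo≤hî : lo α ≤ hî
      lo≤hî = subst₂ _≤_ (sym (lo-formula α∈)) (sym (hat-hi α∈)) (s≤s (+-monoˡ-≤ O (*-monoʳ-≤ 2 L≤R)))
    by-cases (inj₂ R≤L) = begin
      opened α + 2 * (L ⊓ R)   ≡⟨ cong (λ m → opened α + 2 * m) (m≥n⇒m⊓n≡n R≤L) ⟩
      opened α + 2 * R         ≡⟨ cong (_+ 2 * R) same ⟩
      excess α + 2 * R         ∎
      where
      hî≤lo : hî ≤ lo α
      hî≤lo = subst₂ _≤_ (sym (hat-hi α∈)) (sym (lo-formula α∈)) (s≤s (+-monoˡ-≤ O (*-monoʳ-≤ 2 R≤L)))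
      same : opened α ≡ excess α
      same = +-cancelʳ-≡ (lo α) _ _ (trans both-count (cong (excess α +_) (m≥n⇒m⊔n≡m hî≤lo)))

  iL iS iR : Arch → ℕ
  iL α = 𝟙 (inL? α)
  iS α = 𝟙 (inS? α)
  iR α = 𝟙 (inR? α)

  ∑⟨_⟩_ : (Arch → ℕ) → (Arch → ℕ) → ℕ
  ∑⟨ w ⟩ f = ∑[ α ∈ As ] (w α * f α)

  private
    swap-factors : ∀ x y z → x * (y * z) ≡ y * (x * z)
    swap-factors = solve-∀

  ∑⟨⟩-+ : ∀ w (f g : Arch → ℕ) → ∑⟨ w ⟩ (λ α → f α + g α) ≡ ∑⟨ w ⟩ f + ∑⟨ w ⟩ g
  ∑⟨⟩-+ w f g = trans (∑-cong As (λ {α} _ → *-distribˡ-+ (w α) (f α) (g α))) (∑-+ As _ _)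

  ∑⟨⟩-*ˡ : ∀ w c (f : Arch → ℕ) → ∑⟨ w ⟩ (λ α → c * f α) ≡ c * ∑⟨ w ⟩ f
  ∑⟨⟩-*ˡ w c f = trans (∑-cong As (λ {α} _ → swap-factors (w α) c (f α))) (∑-*ˡ As c _)

  ∑⟨⟩-const : ∀ w c → ∑⟨ w ⟩ (λ _ → c) ≡ c * ∑ As w
  ∑⟨⟩-const w c = trans (∑-cong As (λ {α} _ → *-comm (w α) c)) (∑-*ˡ As c w)

  ∑⟨⟩-on : {P : Arch → Set} (P? : ∀ α → Dec (P α)) {f g : Arch → ℕ} →
    (∀ {α} → α ∈ As → P α → f α ≡ g α) → ∑⟨ (λ α → 𝟙 (P? α)) ⟩ f ≡ ∑⟨ (λ α → 𝟙 (P? α)) ⟩ g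
  ∑⟨⟩-on P? h = ∑-cong As (λ {α} α∈ → 𝟙-guard (P? α) (h α∈))

  ∑⟨⟩-swap : ∀ w v (r : Arch → Arch → ℕ) →
    ∑⟨ w ⟩ (λ α → ∑⟨ v ⟩ (r α)) ≡ ∑⟨ v ⟩ (λ β → ∑⟨ w ⟩ (λ α → r α β))
  ∑⟨⟩-swap w v r = begin
    ∑[ α ∈ As ] (w α * ∑[ β ∈ As ] (v β * r α β))   ≡⟨ ∑-cong As (λ {α} _ → sym (∑-*ˡ As (w α) _)) ⟩
    ∑[ α ∈ As ] ∑[ β ∈ As ] (w α * (v β * r α β))   ≡⟨ ∑-swap As As _ ⟩
    ∑[ β ∈ As ] ∑[ α ∈ As ] (w α * (v β * r α β))   ≡⟨ ∑-cong As (λ {β} _ → trans (∑-cong As (λ {α} _ → swap-factors (w α) (v β) (r α β)))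
                                                                              (∑-*ˡ As (v β) _)) ⟩
    ∑[ β ∈ As ] (v β * ∑[ α ∈ As ] (w α * r α β))   ∎
    where open ≡-Reasoning

  ∑⟨⟩-closed : {P Q : Arch → Set} (P? : ∀ α → Dec (P α)) (Q? : ∀ α → Dec (Q α))
    {R : Arch → Arch → Set} (R? : ∀ α β → Dec (R α β)) →
    (∀ {α β} → α ∈ As → β ∈ As → P α → R α β → Q β) →
    ∑⟨ (λ α → 𝟙 (P? α)) ⟩ (λ α → ∑[ β ∈ As ] 𝟙 (R? α β))
    ≡ ∑⟨ (λ α → 𝟙 (P? α)) ⟩ (λ α → ∑⟨ (λ β → 𝟙 (Q? β)) ⟩ (λ β → 𝟙 (R? α β)))
  ∑⟨⟩-closed {P} {Q} P? Q? {R} R? closed = ∑⟨⟩-on P? (λ α∈ Pα → ∑-cong As (λ β∈ → only-Q α∈ β∈ Pα))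
    where
    only-Q : ∀ {α β} → α ∈ As → β ∈ As → P α → 𝟙 (R? α β) ≡ 𝟙 (Q? β) * 𝟙 (R? α β)
    only-Q {α} {β} α∈ β∈ Pα with R? α β
    ... | yes r = sym (cong (_* 1) (𝟙-yes (Q? β) (closed α∈ β∈ Pα r)))
    ... | no _  = sym (*-zeroʳ (𝟙 (Q? β)))

  class-partition : ∀ {α} → α ∈ As → iL α + iS α + iR α ≡ 1
  class-partition {α} α∈ with classify α
  ... | left αL   rewrite 𝟙-yes (inL? α) αL | 𝟙-no (inS? α) (L⇒¬S αL) | 𝟙-no (inR? α) (L⇒¬R α∈ αL) = refl
  ... | middle αS rewrite 𝟙-no (inL? α) (λ αL → L⇒¬S αL αS) | 𝟙-yes (inS? α) αS | 𝟙-no (inR? α) (S⇒¬R αS) = refl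
  ... | right αR  rewrite 𝟙-no (inL? α) (λ αL → L⇒¬R α∈ αL αR) | 𝟙-no (inS? α) (λ αS → S⇒¬R αS αR) | 𝟙-yes (inR? α) αR = refl

  split-by-class : ∀ (f : Arch → ℕ) → ∑ As f ≡ ∑⟨ iL ⟩ f + ∑⟨ iS ⟩ f + ∑⟨ iR ⟩ f
  split-by-class f = begin
    ∑ As f                                             ≡⟨ ∑-cong As (λ {α} α∈ → sym (trans (cong (_* f α) (class-partition α∈)) (+-identityʳ (f α)))) ⟩
    ∑[ α ∈ As ] ((iL α + iS α + iR α) * f α)           ≡⟨ ∑-cong As (λ {α} _ → distrib (iL α) (iS α) (iR α) (f α)) ⟩
    ∑[ α ∈ As ] (iL α * f α + iS α * f α + iR α * f α) ≡⟨ trans (∑-+ As _ _) (cong (_+ ∑⟨ iR ⟩ f) (∑-+ As _ _)) ⟩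
    ∑⟨ iL ⟩ f + ∑⟨ iS ⟩ f + ∑⟨ iR ⟩ f                  ∎
    where
    open ≡-Reasoning
    distrib : ∀ a b c x → (a + b + c) * x ≡ a * x + b * x + c * x
    distrib = solve-∀

  -- Counting the pairs inside one class with the pair trichotomy: the W² ordered
  -- pairs of class members are the W diagonal pairs and, twice over, the
  -- disjoint and the nested pairs.
  class-pairs : {P : Arch → Set} (P? : ∀ α → Dec (P α)) →
    let w = λ α → 𝟙 (P? α) in
    2 * ∑⟨ w ⟩ (λ α → ∑⟨ w ⟩ (λ β → before β α)) + 2 * ∑⟨ w ⟩ (λ α → ∑⟨ w ⟩ (λ β → encloses α β)) + ∑ As w
    ≡ ∑ As w * ∑ As w
  class-pairs P? = begin
    2 * D r₁ + 2 * D r₄ + W                  ≡⟨ twice (D r₁) (D r₄) W ⟩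
    D r₁ + D r₁ + D r₄ + D r₄ + W            ≡⟨ cong₂ (λ a b → D r₁ + a + b + D r₄ + W) (sym (∑⟨⟩-swap w w (λ α β → before α β)))
                                                      (∑⟨⟩-swap w w (λ α β → encloses α β)) ⟩
    D r₁ + D r₂ + D r₃ + D r₄ + W            ≡⟨ cong (D r₁ + D r₂ + D r₃ + D r₄ +_) (sym diagonal) ⟩
    D r₁ + D r₂ + D r₃ + D r₄ + D r₅         ≡⟨ sym expand ⟩
    D (λ β α → r₁ β α + r₂ β α + r₃ β α + r₄ β α + r₅ β α)
                                             ≡⟨ all-pairs ⟩
    W * W                                    ∎
    where
    open ≡-Reasoning
    w : Arch → ℕ
    w α = 𝟙 (P? α)
    W : ℕ
    W = ∑ As w
    D : (Arch → Arch → ℕ) → ℕ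
    D r = ∑⟨ w ⟩ (λ α → ∑⟨ w ⟩ (λ β → r β α))
    r₁ r₂ r₃ r₄ r₅ : Arch → Arch → ℕ
    r₁ β α = before β α
    r₂ β α = before α β
    r₃ β α = encloses β α
    r₄ β α = encloses α β
    r₅ β α = 𝟙 (lo β ≟ lo α)
    twice : ∀ a b c → 2 * a + 2 * b + c ≡ a + a + b + b + c
    twice = solve-∀
    D-+ : ∀ r s → D (λ β α → r β α + s β α) ≡ D r + D s
    D-+ r s = trans (∑-cong As (λ {α} _ → cong (w α *_) (∑⟨⟩-+ w (λ β → r β α) (λ β → s β α)))) (∑⟨⟩-+ w _ _)
    expand : D (λ β α → r₁ β α + r₂ β α + r₃ β α + r₄ β α + r₅ β α) ≡ D r₁ + D r₂ + D r₃ + D r₄ + D r₅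
    expand = trans (D-+ _ r₅) (cong (_+ D r₅) (trans (D-+ _ r₄) (cong (_+ D r₄) (trans (D-+ _ r₃) (cong (_+ D r₃) (D-+ r₁ r₂))))))
    all-pairs : D (λ β α → r₁ β α + r₂ β α + r₃ β α + r₄ β α + r₅ β α) ≡ W * W
    all-pairs = begin
      D (λ β α → r₁ β α + r₂ β α + r₃ β α + r₄ β α + r₅ β α)
        ≡⟨ ∑-cong As (λ {α} α∈ → cong (w α *_) (∑-cong As (λ {β} β∈ → cong (w β *_) (pair-trichotomy α∈ β∈)))) ⟩
      ∑⟨ w ⟩ (λ _ → ∑⟨ w ⟩ (λ _ → 1))   ≡⟨ ∑-cong As (λ {α} _ → cong (w α *_) (∑⟨⟩-const w 1)) ⟩
      ∑⟨ w ⟩ (λ _ → 1 * W)              ≡⟨ ∑⟨⟩-const w (1 * W) ⟩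
      1 * W * W                         ≡⟨ cong (_* W) (*-identityˡ W) ⟩
      W * W                             ∎
    -- the diagonal: the only class member with the same left endpoint as α is α
    diagonal : D r₅ ≡ W
    diagonal = begin
      D r₅                                             ≡⟨ ∑-cong As (λ {α} α∈ → cong (w α *_) (∑-cong As (λ {β} β∈ → same-weight α∈ β∈ (lo β ≟ lo α)))) ⟩
      ∑⟨ w ⟩ (λ α → ∑[ β ∈ As ] (w α * 𝟙 (lo β ≟ lo α))) ≡⟨ ∑-cong As (λ {α} α∈ → cong (w α *_) (trans (∑-*ˡ As (w α) _)
                                                                (trans (cong (w α *_) (opensAt-lo≡1 α∈)) (*-identityʳ (w α))))) ⟩
      ∑[ α ∈ As ] (w α * w α)                          ≡⟨ ∑-cong As (λ {α} _ → 𝟙-idem (P? α)) ⟩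
      W                                                ∎
      where
      same-weight : ∀ {α β} → α ∈ As → β ∈ As → (e : Dec (lo β ≡ lo α)) → w β * 𝟙 e ≡ w α * 𝟙 e
      same-weight α∈ β∈ (yes lβ≡lα) = cong (λ γ → w γ * 1) (lo-injective β∈ α∈ lβ≡lα)
      same-weight {α} {β} α∈ β∈ (no _) = trans (*-zeroʳ (w β)) (sym (*-zeroʳ (w α)))

  -- Arches to the left of, or inside, an arch on the left are on the left; arches
  -- to the right of, or inside, an arch on the right are on the right.
  pairs-L : 2 * ∑⟨ iL ⟩ nLeft + 2 * ∑⟨ iL ⟩ nInner + ∑ As iL ≡ ∑ As iL * ∑ As iL
  pairs-L = trans (cong₂ (λ a b → 2 * a + 2 * b + ∑ As iL)
                     (∑⟨⟩-closed inL? inL? (λ α β → hi β <? lo α)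
                        (λ α∈ β∈ αL hβ<lα → <⇒≤ (<-≤-trans (<-trans hβ<lα (lo<hi α∈)) αL)))
                     (∑⟨⟩-closed inL? inL? (λ α β → (lo α <? lo β) ×-dec (lo β <? hi α)) inside-L))
                  (class-pairs inL?)
    where
    inside-L : ∀ {α β} → α ∈ As → β ∈ As → InL α → lo α < lo β × lo β < hi α → InL β
    inside-L {α} {β} α∈ β∈ αL (lα<lβ , lβ<hα) with <-cmp (hi β) (hi α)
    ... | tri< hβ<hα _ _ = <⇒≤ (<-≤-trans hβ<hα αL)
    ... | tri≈ _ hβ≡hα _ = ⊥-elim (<-irrefl (cong lo (hi-injective α∈ β∈ (sym hβ≡hα))) lα<lβ)
    ... | tri> _ _ hα<hβ = ⊥-elim (no-crossing α∈ β∈ (lα<lβ , lβ<hα , hα<hβ))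

  pairs-R : 2 * ∑⟨ iR ⟩ nRight + 2 * ∑⟨ iR ⟩ nInner + ∑ As iR ≡ ∑ As iR * ∑ As iR
  pairs-R = trans (cong₂ (λ a b → 2 * a + 2 * b + ∑ As iR)
                     (trans (∑⟨⟩-closed inR? inR? (λ α β → hi α <? lo β)
                               (λ α∈ β∈ αR hα<lβ → <-trans αR (<-trans (lo<hi α∈) hα<lβ)))
                            (∑⟨⟩-swap iR iR (λ α β → before α β)))
                     (∑⟨⟩-closed inR? inR? (λ α β → (lo α <? lo β) ×-dec (lo β <? hi α))
                        (λ α∈ β∈ αR (lα<lβ , _) → <-trans αR lα<lβ)))
                  (class-pairs inR?)

  right-left : ∑⟨ iR ⟩ nLeft ≡ ∑ As iL * ∑ As iR + ∑⟨ iS ⟩ nRight + ∑⟨ iR ⟩ nRight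
  right-left = begin
    ∑⟨ iR ⟩ nLeft
      ≡⟨ ∑-cong As (λ {α} _ → cong (iR α *_) (split-by-class (λ β → before β α))) ⟩
    ∑⟨ iR ⟩ (λ α → ∑⟨ iL ⟩ (λ β → before β α) + ∑⟨ iS ⟩ (λ β → before β α) + ∑⟨ iR ⟩ (λ β → before β α))
      ≡⟨ trans (∑⟨⟩-+ iR _ _) (cong (_+ ∑⟨ iR ⟩ (λ α → ∑⟨ iR ⟩ (λ β → before β α))) (∑⟨⟩-+ iR _ _)) ⟩
    ∑⟨ iR ⟩ (λ α → ∑⟨ iL ⟩ (λ β → before β α)) + ∑⟨ iR ⟩ (λ α → ∑⟨ iS ⟩ (λ β → before β α))
      + ∑⟨ iR ⟩ (λ α → ∑⟨ iR ⟩ (λ β → before β α))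
      ≡⟨ cong₂ (λ a b → a + b + ∑⟨ iR ⟩ (λ α → ∑⟨ iR ⟩ (λ β → before β α))) all-L (∑⟨⟩-swap iR iS (λ α β → before β α)) ⟩
    ∑ As iL * ∑ As iR + ∑⟨ iS ⟩ (λ β → ∑⟨ iR ⟩ (λ α → before β α)) + ∑⟨ iR ⟩ (λ α → ∑⟨ iR ⟩ (λ β → before β α))
      ≡⟨ cong₂ (λ a b → ∑ As iL * ∑ As iR + a + b)
               (sym (∑⟨⟩-closed inS? inR? (λ β α → hi β <? lo α) (λ β∈ α∈ (_ , n<hβ) hβ<lα → <-trans n<hβ hβ<lα)))
               (trans (∑⟨⟩-swap iR iR (λ α β → before β α))
                      (sym (∑⟨⟩-closed inR? inR? (λ β α → hi β <? lo α) (λ β∈ α∈ βR hβ<lα → <-trans βR (<-trans (lo<hi β∈) hβ<lα))))) ⟩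
    ∑ As iL * ∑ As iR + ∑⟨ iS ⟩ nRight + ∑⟨ iR ⟩ nRight ∎
    where
    open ≡-Reasoning
    all-L : ∑⟨ iR ⟩ (λ α → ∑⟨ iL ⟩ (λ β → before β α)) ≡ ∑ As iL * ∑ As iR
    all-L = begin
      ∑⟨ iR ⟩ (λ α → ∑⟨ iL ⟩ (λ β → before β α))
        ≡⟨ ∑⟨⟩-on inR? (λ α∈ αR → ∑⟨⟩-on inL? (λ β∈ βL → 𝟙-yes (_ <? _) (≤-<-trans βL αR))) ⟩
      ∑⟨ iR ⟩ (λ _ → ∑⟨ iL ⟩ (λ _ → 1))
        ≡⟨ ∑⟨⟩-const iR (∑⟨ iL ⟩ (λ _ → 1)) ⟩
      ∑⟨ iL ⟩ (λ _ → 1) * ∑ As iR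
        ≡⟨ cong (_* ∑ As iR) (trans (∑⟨⟩-const iL 1) (*-identityˡ _)) ⟩
      ∑ As iL * ∑ As iR ∎

  private
    indicator-values : ∀ {a b l s x y u v : ℕ} → a ≡ x → b ≡ y → l ≡ u → s ≡ v → x + y ≡ 2 * u + v → a + b ≡ 2 * l + s
    indicator-values refl refl refl refl e = e

  lower-endpoints : ∀ {α} → α ∈ As → 𝟙 (lo α ≤? n) + 𝟙 (hi α ≤? n) ≡ 2 * iL α + iS α
  lower-endpoints {α} α∈ with classify α
  ... | left αL   = indicator-values (𝟙-yes (lo α ≤? n) (<⇒≤ (<-≤-trans (lo<hi α∈) αL))) (𝟙-yes (hi α ≤? n) αL)
                                     (𝟙-yes (inL? α) αL) (𝟙-no (inS? α) (L⇒¬S αL)) refl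
  ... | middle αS = indicator-values (𝟙-yes (lo α ≤? n) (proj₁ αS)) (𝟙-no (hi α ≤? n) (λ αL → L⇒¬S αL αS))
                                     (𝟙-no (inL? α) (λ αL → L⇒¬S αL αS)) (𝟙-yes (inS? α) αS) refl
  ... | right αR  = indicator-values (𝟙-no (lo α ≤? n) (λ lo≤n → <-irrefl refl (<-≤-trans αR lo≤n)))
                                     (𝟙-no (hi α ≤? n) (λ αL → L⇒¬R α∈ αL αR))
                                     (𝟙-no (inL? α) (λ αL → L⇒¬R α∈ αL αR)) (𝟙-no (inS? α) (λ αS → S⇒¬R αS αR)) refl

  upper-endpoints : ∀ {α} → α ∈ As → 𝟙 (n <? lo α) + 𝟙 (n <? hi α) ≡ 2 * iR α + iS α
  upper-endpoints {α} α∈ with classify α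
  ... | left αL   = indicator-values (𝟙-no (n <? lo α) (L⇒¬R α∈ αL)) (𝟙-no (n <? hi α) (λ n<hi → <-irrefl refl (<-≤-trans n<hi αL)))
                                     (𝟙-no (inR? α) (L⇒¬R α∈ αL)) (𝟙-no (inS? α) (L⇒¬S αL)) refl
  ... | middle αS = indicator-values (𝟙-no (n <? lo α) (S⇒¬R αS)) (𝟙-yes (n <? hi α) (proj₂ αS))
                                     (𝟙-no (inR? α) (S⇒¬R αS)) (𝟙-yes (inS? α) αS) refl
  ... | right αR  = indicator-values (𝟙-yes (n <? lo α) αR) (𝟙-yes (n <? hi α) (<-trans αR (lo<hi α∈)))
                                     (𝟙-yes (inR? α) αR) (𝟙-no (inS? α) (λ αS → S⇒¬R αS αR)) refl

  -- The middle position n splits [1, 2n] into halves of equal size, so there are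
  -- as many arches on the left as on the right.
  #L≡#R : ∑ As iL ≡ ∑ As iR
  #L≡#R = *-cancelˡ-≡ _ _ 2 (+-cancelʳ-≡ (∑ As iS) _ _ (begin
    2 * ∑ As iL + ∑ As iS                          ≡⟨ sym (class-sum iL iS) ⟩
    ∑[ α ∈ As ] (2 * iL α + iS α)                  ≡⟨ sym (∑-cong As lower-endpoints) ⟩
    ∑[ α ∈ As ] (𝟙 (lo α ≤? n) + 𝟙 (hi α ≤? n))    ≡⟨ lower-half ⟩
    n                                              ≡⟨ sym upper-half ⟩
    ∑[ α ∈ As ] (𝟙 (n <? lo α) + 𝟙 (n <? hi α))    ≡⟨ ∑-cong As upper-endpoints ⟩
    ∑[ α ∈ As ] (2 * iR α + iS α)                  ≡⟨ class-sum iR iS ⟩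
    2 * ∑ As iR + ∑ As iS                          ∎))
    where
    open ≡-Reasoning
    class-sum : ∀ u v → ∑[ α ∈ As ] (2 * u α + v α) ≡ 2 * ∑ As u + ∑ As v
    class-sum u v = trans (∑-+ As _ _) (cong (_+ ∑ As v) (∑-*ˡ As 2 u))
    lower-half : ∑[ α ∈ As ] (𝟙 (lo α ≤? n) + 𝟙 (hi α ≤? n)) ≡ n
    lower-half = trans (∑-positions (λ x → 𝟙 (x ≤? n))) (trans (count-≤ (2 * n) n) (m≥n⇒m⊓n≡n (m≤m+n n (n + 0))))
    upper-half : ∑[ α ∈ As ] (𝟙 (n <? lo α) + 𝟙 (n <? hi α)) ≡ n
    upper-half = trans (∑-positions (λ x → 𝟙 (n <? x))) (+-cancelʳ-≡ (suc n) _ _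
      (trans (count-≥ (2 * n) (suc n) (s≤s z≤n) (s≤s (m≤m+n n (n + 0))))
        (sym (trans (+-suc n n) (cong (λ m → suc (n + m)) (sym (+-identityʳ n)))))))

  sum-L : ∑⟨ iL ⟩ opened + ∑⟨ iL ⟩ nLeft ≡ ∑⟨ iL ⟩ nRight + ∑⟨ iL ⟩ nInner
  sum-L = trans (sym (∑⟨⟩-+ iL opened nLeft)) (trans (∑⟨⟩-on inL? identity-L) (∑⟨⟩-+ iL nRight nInner))

  sum-R : ∑⟨ iR ⟩ excess + (∑ As iR + (∑⟨ iR ⟩ nRight + ∑⟨ iR ⟩ nInner)) ≡ ∑⟨ iR ⟩ nLeft
  sum-R = begin
    ∑⟨ iR ⟩ excess + (∑ As iR + (∑⟨ iR ⟩ nRight + ∑⟨ iR ⟩ nInner))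
      ≡⟨ cong (λ z → ∑⟨ iR ⟩ excess + (z + (∑⟨ iR ⟩ nRight + ∑⟨ iR ⟩ nInner)))
              (sym (trans (∑⟨⟩-const iR 1) (*-identityˡ (∑ As iR)))) ⟩
    ∑⟨ iR ⟩ excess + (∑⟨ iR ⟩ (λ _ → 1) + (∑⟨ iR ⟩ nRight + ∑⟨ iR ⟩ nInner))
      ≡⟨ sym (trans (∑⟨⟩-+ iR excess (λ α → suc (nRight α + nInner α)))
                    (cong (∑⟨ iR ⟩ excess +_) (trans (∑⟨⟩-+ iR (λ _ → 1) (λ α → nRight α + nInner α))
                                                     (cong (∑⟨ iR ⟩ (λ _ → 1) +_) (∑⟨⟩-+ iR nRight nInner))))) ⟩
    ∑⟨ iR ⟩ (λ α → excess α + suc (nRight α + nInner α))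
      ≡⟨ ∑⟨⟩-on inR? identity-R ⟩
    ∑⟨ iR ⟩ nLeft ∎
    where open ≡-Reasoning

  sum-S : ∑⟨ iS ⟩ opened + 2 * ∑⟨ iS ⟩ (λ α → nLeft α ⊓ nRight α) ≡ ∑⟨ iS ⟩ excess + 2 * ∑⟨ iS ⟩ nRight
  sum-S = begin
    ∑⟨ iS ⟩ opened + 2 * ∑⟨ iS ⟩ (λ α → nLeft α ⊓ nRight α)
      ≡⟨ sym (trans (∑⟨⟩-+ iS _ _) (cong (∑⟨ iS ⟩ opened +_) (∑⟨⟩-*ˡ iS 2 _))) ⟩
    ∑⟨ iS ⟩ (λ α → opened α + 2 * (nLeft α ⊓ nRight α))
      ≡⟨ ∑⟨⟩-on inS? identity-S ⟩
    ∑⟨ iS ⟩ (λ α → excess α + 2 * nRight α)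
      ≡⟨ trans (∑⟨⟩-+ iS _ _) (cong (∑⟨ iS ⟩ excess +_) (∑⟨⟩-*ˡ iS 2 nRight)) ⟩
    ∑⟨ iS ⟩ excess + 2 * ∑⟨ iS ⟩ nRight ∎
    where open ≡-Reasoning

  -- Half the difference d(π) − Σ_p m_p.
  K : ℕ
  K = ∑⟨ iL ⟩ nLeft + ∑⟨ iR ⟩ nRight + ∑⟨ iS ⟩ (λ α → nLeft α ⊓ nRight α)

  decomposition : d n π ≡ sumM n π + 2 * K
  decomposition = +-cancelʳ-≡ (∑ As excess) _ _ (begin
    d n π + ∑ As excess
      ≡⟨ cong₂ _+_ (trans d-formula (split-by-class nLeft)) (split-by-class excess) ⟩
    (∑⟨ iL ⟩ nLeft + ∑⟨ iS ⟩ nLeft + ∑⟨ iR ⟩ nLeft) + (∑⟨ iL ⟩ excess + ∑⟨ iS ⟩ excess + ∑⟨ iR ⟩ excess)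
      ≡⟨ class-bookkeeping (∑⟨ iL ⟩ nLeft) (∑⟨ iS ⟩ nLeft) (∑⟨ iR ⟩ nLeft) (∑⟨ iL ⟩ nRight) (∑⟨ iS ⟩ nRight) (∑⟨ iR ⟩ nRight)
           (∑⟨ iL ⟩ nInner) (∑⟨ iR ⟩ nInner) (∑⟨ iL ⟩ opened) (∑⟨ iS ⟩ opened) (∑⟨ iR ⟩ opened)
           (∑⟨ iL ⟩ excess) (∑⟨ iS ⟩ excess) (∑⟨ iR ⟩ excess) (∑⟨ iS ⟩ (λ α → nLeft α ⊓ nRight α)) (∑ As iL) (∑ As iR)
           sum-L (trans (∑⟨⟩-on inL? excess-L) (∑⟨⟩-const iL 0)) (trans (∑⟨⟩-on inR? (λ {α} _ → opened-R {α})) (∑⟨⟩-const iR 0))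
           sum-R sum-S left-right right-left pairs-L pairs-R #L≡#R ⟩
    (∑⟨ iL ⟩ opened + ∑⟨ iS ⟩ opened + ∑⟨ iR ⟩ opened) + 2 * K
      ≡⟨ cong (_+ 2 * K) (trans (sym (split-by-class opened)) (sym sumM-formula)) ⟩
    sumM n π + ∑ As excess + 2 * K
      ≡⟨ swap-last (sumM n π) (∑ As excess) (2 * K) ⟩
    sumM n π + 2 * K + ∑ As excess ∎)
    where
    open ≡-Reasoning
    swap-last : ∀ a b c → a + b + c ≡ a + c + b
    swap-last = solve-∀
    -- every disjoint pair is counted once from each side
    left-right : ∑⟨ iL ⟩ nLeft + ∑⟨ iS ⟩ nLeft + ∑⟨ iR ⟩ nLeft ≡ ∑⟨ iL ⟩ nRight + ∑⟨ iS ⟩ nRight + ∑⟨ iR ⟩ nRight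
    left-right = trans (sym (split-by-class nLeft)) (trans (∑-swap As As (λ α β → before β α)) (split-by-class nRight))

proposition3p3 : (n : ℕ) (π : NCMatching n) →
    (sumM n π ≤ d n π) × (2 ∣ (d n π ∸ sumM n π))
proposition3p3 n π = sumM≤d , 2∣d∸sumM
  where
  open Matching π using (K; decomposition)
  sumM≤d : sumM n π ≤ d n π
  sumM≤d = subst (sumM n π ≤_) (sym decomposition) (m≤m+n (sumM n π) (2 * K))
  2∣d∸sumM : 2 ∣ (d n π ∸ sumM n π)
  2∣d∸sumM = divides K (begin
    d n π ∸ sumM n π              ≡⟨ cong (_∸ sumM n π) decomposition ⟩
    sumM n π + 2 * K ∸ sumM n π   ≡⟨ m+n∸m≡n (sumM n π) (2 * K) ⟩
    2 * K                         ≡⟨ *-comm 2 K ⟩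
    K * 2                         ∎)
    where open ≡-Reasoning
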